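{- Let $n\ge 6$ be even and let $\mathcal{T}_n$ be the set of the four ribbon $L$-shaped $n$-ominoes described in the context (only translations allowed). A $p\times q$ rectangle ($p,q\ge 1$ integers) admits a signed tiling by $\mathcal{T}_n$ if and only if either both $p$ and $q$ are even and at least one of them is divisible by $n$, or one of $p,q$ is odd and the other is divisible by $n\left(\frac{n}{2}-2\right)$.
   Context: Identify the unit cell $[a,a+1]\times[b,b+1]$ of the square lattice with $(a,b)\in\mathbb{Z}^2$. For $n$ even, $\mathcal{T}_n$ consists of all integer translates of the four polyominoes with cell sets $\{(0,j):0\le j\le n-2\}\cup\{(1,0)\}$, $\{(1,j):0\le j\le n-2\}\cup\{(0,n-2)\}$, $\{(i,0):0\le i\le n-2\}\cup\{(0,1)\}$, and $\{(i,1):0\le i\le n-2\}\cup\{(n-2,0)\}$ (no rotations or reflections other than these). A signed tiling of a region $R$ (a finite set of cells) by a set of tiles is a finite collection of translated tiles, each with weight $+1$ or $-1$, such that for every cell of $R$ the sum of the weights of the tiles containing it is $1$ and for every cell outside $R$ this sum is $0$. -}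

module Defs where

open import Data.Nat as ℕ using (ℕ)
open import Data.Nat.Divisibility using (_∣_)
open import Data.Integer as ℤ using (ℤ; +_; _-_; 0ℤ; 1ℤ; -1ℤ; _≟_; _≤?_; _<?_)
open import Data.Fin using (Fin; zero; suc)
open import Data.Bool using (Bool; true; false; _∧_; _∨_; if_then_else_)
open import Data.List using (List; []; _∷_; map)
open import Data.Product using (_×_; _,_)
open import Data.Sign using (Sign)
open import Relation.Nullary.Decidable using (⌊_⌋)
open import Relation.Nullary using (¬_)

-- A cell is identified with the lower-left corner (a , b) of [a,a+1]×[b,b+1].
Cell : Set
Cell = ℤ × ℤ

_==_ : ℤ → ℤ → Bool
x == y = ⌊ x ≟ y ⌋

inRange : ℤ → ℤ → ℤ → Bool
inRange lo hi x = ⌊ lo ≤? x ⌋ ∧ ⌊ x ≤? hi ⌋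

inShape : ℕ → Fin 4 → Cell → Bool
inShape n zero (i , j) =
  ((i == 0ℤ) ∧ inRange 0ℤ (+ n - + 2) j) ∨ ((i == 1ℤ) ∧ (j == 0ℤ))
inShape n (suc zero) (i , j) =
  ((i == 1ℤ) ∧ inRange 0ℤ (+ n - + 2) j) ∨ ((i == 0ℤ) ∧ (j == (+ n - + 2)))
inShape n (suc (suc zero)) (i , j) =
  ((j == 0ℤ) ∧ inRange 0ℤ (+ n - + 2) i) ∨ ((i == 0ℤ) ∧ (j == 1ℤ))
inShape n (suc (suc (suc zero))) (i , j) =
  ((j == 1ℤ) ∧ inRange 0ℤ (+ n - + 2) i) ∨ ((i == (+ n - + 2)) ∧ (j == 0ℤ))

record PlacedTile : Set where
  constructor placed
  field
    shape  : Fin 4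
    offset : Cell
    weight : Sign

signToℤ : Sign → ℤ
signToℤ Sign.+ = 1ℤ
signToℤ Sign.- = -1ℤ

contains : ℕ → PlacedTile → Cell → Bool
contains n (placed s (a , b) _) (x , y) = inShape n s (x - a , y - b)

contrib : ℕ → PlacedTile → Cell → ℤ
contrib n t c = if contains n t c then signToℤ (PlacedTile.weight t) else 0ℤ

coverage : ℕ → List PlacedTile → Cell → ℤ
coverage n [] c = 0ℤ
coverage n (t ∷ ts) c = contrib n t c ℤ.+ coverage n ts c

inRect : ℕ → ℕ → Cell → Bool
inRect p q (x , y) = ⌊ 0ℤ ≤? x ⌋ ∧ ⌊ x <? + p ⌋ ∧ ⌊ 0ℤ ≤? y ⌋ ∧ ⌊ y <? + q ⌋

indicator : Bool → ℤ
indicator true  = 1ℤ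
indicator false = 0ℤ

IsSignedTiling : ℕ → ℕ → ℕ → List PlacedTile → Set
IsSignedTiling n p q ts = ∀ (c : Cell) → coverage n ts c ≡ indicator (inRect p q c)
  where open import Relation.Binary.PropositionalEquality using (_≡_)

data SignedTileable (n p q : ℕ) : Set where
  tiling : (ts : List PlacedTile) → IsSignedTiling n p q ts → SignedTileable n p q

Even : ℕ → Set
Even m = 2 ∣ m

Odd : ℕ → Set
Odd m = ¬ (2 ∣ m)

-- Necessity. If a weight f : ℤ² → ℤ sums to a multiple of M over every placed tile, it sums to a
-- multiple of M over every signed-tileable rectangle: sum f over a box containing all tiles, each tile
-- being the sum of two rectangle indicators. Writing n = 2k + 2, three weights suffice:
--   (−1)^(x+y) sums to 0 over every tile and to 1 over an odd × odd rectangle;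
--   (−1)^(x+y)·(kx + y) has tile sums divisible by (k + 1)(k − 1) and sums to −r over a (2l+1) × 2r
--   rectangle, so n(n/2 − 2) = 2(k + 1)(k − 1) divides 2r;
--   n·[n ∣ y − x] − 1 sums to 0 over every tile, while its rectangle sums are n-periodic in both sides
--   and equal p(n − q) ≠ 0 for 0 < p ≤ q < n, so n divides a side.
-- Sufficiency. Two tiles form a 2 × n rectangle, and a signed combination of tiles, obtained by moving
-- single cells by (−2, n − 2), is a 1 × n(n/2 − 2) column; the rest is stacking.

module Submission where

module RibbonTilings where

  open import Defs
  open import Algebra.Bundles using (AbelianGroup)
  open import Data.Bool using (Bool; true; false; _∧_; _∨_; if_then_else_)
  import Data.Bool.Properties as BoolP
  open import Data.Fin using (Fin; zero; suc)
  open import Data.Integer as ℤ using (ℤ; +_; -[1+_]; _+_; _*_; _-_; -_; 0ℤ; 1ℤ; -1ℤ; ∣_∣; _≟_; _≤?_; _<?_)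
  import Data.Integer.Properties as ℤP
  import Data.Integer.Divisibility.Signed as ℤD
  open ℤD using (_∣_; _∣?_; divides; ∣m∣n⇒∣m+n; ∣n⇒∣m*n; 0∣⇒≡0)
  open import Data.Integer.Tactic.RingSolver using (solve-∀)
  open import Data.List using (List; []; _∷_; _++_; map)
  open import Data.Nat as ℕ using (ℕ; zero; suc; z≤n; s≤s; _∸_)
  import Data.Nat.Properties as ℕP
  import Data.Nat.Divisibility as ℕD
  open ℕD using (divides)
  open import Data.Nat.DivMod using (_%_; _/_; m≡m%n+[m/n]*n; m%n<n)
  open import Data.Nat.Tactic.RingSolver using () renaming (solve-∀ to solveℕ-∀)
  open import Data.Product using (Σ; ∃; ∃₂; _×_; _,_; proj₁; proj₂)
  open import Data.Sign using (Sign)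
  open import Data.Sum using (_⊎_; inj₁; inj₂)
  open import Function.Bundles using (_⇔_; mk⇔; Equivalence)
  open import Relation.Binary.Definitions using (tri<; tri≈; tri>)
  open import Relation.Binary.PropositionalEquality
  open import Relation.Nullary using (¬_; Dec; yes; no; contradiction)
  open import Relation.Nullary.Decidable using (⌊_⌋; isYes≗does; does-⇔; dec-true)
  open import Algebra.Properties.Group (AbelianGroup.group ℤP.+-0-abelianGroup) using (∙-cancelˡ)
  open ≡-Reasoning

  -- Finite sums

  ∑ : ℕ → (ℕ → ℤ) → ℤ
  ∑ zero    g = 0ℤ
  ∑ (suc k) g = g 0 + ∑ k (λ i → g (suc i))

  infix 10 ∑
  syntax ∑ k (λ i → e) = ∑[ i < k ] e

  ∑-cong-< : ∀ k {g h : ℕ → ℤ} → (∀ i → i ℕ.< k → g i ≡ h i) → ∑ k g ≡ ∑ k h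
  ∑-cong-< zero    eq = refl
  ∑-cong-< (suc k) eq = cong₂ _+_ (eq 0 (s≤s z≤n)) (∑-cong-< k (λ i i<k → eq (suc i) (s≤s i<k)))

  ∑-cong : ∀ k {g h : ℕ → ℤ} → (∀ i → g i ≡ h i) → ∑ k g ≡ ∑ k h
  ∑-cong k eq = ∑-cong-< k (λ i _ → eq i)

  ∑-const : ∀ k c → ∑[ i < k ] c ≡ + k * c
  ∑-const zero    c = sym (ℤP.*-zeroˡ c)
  ∑-const (suc k) c = trans (cong (_+_ c) (∑-const k c)) (sym (ℤP.suc-* (+ k) c))

  ∑-zero : ∀ k {g : ℕ → ℤ} → (∀ i → i ℕ.< k → g i ≡ 0ℤ) → ∑ k g ≡ 0ℤ
  ∑-zero k {g} eq = trans (∑-cong-< k eq) (trans (∑-const k 0ℤ) (ℤP.*-zeroʳ (+ k)))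

  ∑-distrib-+ : ∀ k (g h : ℕ → ℤ) → ∑[ i < k ] (g i + h i) ≡ ∑ k g + ∑ k h
  ∑-distrib-+ zero    g h = refl
  ∑-distrib-+ (suc k) g h = trans (cong (_+_ (g 0 + h 0)) (∑-distrib-+ k _ _)) (swap (g 0) (h 0) _ _)
    where swap : ∀ a b c d → a + b + (c + d) ≡ a + c + (b + d)
          swap = solve-∀

  ∑-distrib-sub : ∀ k (g h : ℕ → ℤ) → ∑[ i < k ] (g i - h i) ≡ ∑ k g - ∑ k h
  ∑-distrib-sub zero    g h = refl
  ∑-distrib-sub (suc k) g h = trans (cong (_+_ (g 0 - h 0)) (∑-distrib-sub k _ _)) (swap (g 0) (h 0) _ _)
    where swap : ∀ a b c d → a - b + (c - d) ≡ a + c - (b + d)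
          swap = solve-∀

  ∑-*ˡ : ∀ k c (g : ℕ → ℤ) → ∑[ i < k ] (c * g i) ≡ c * ∑ k g
  ∑-*ˡ zero    c g = sym (ℤP.*-zeroʳ c)
  ∑-*ˡ (suc k) c g = trans (cong (_+_ (c * g 0)) (∑-*ˡ k c _)) (sym (ℤP.*-distribˡ-+ c (g 0) _))

  ∑-*ʳ : ∀ k c (g : ℕ → ℤ) → ∑[ i < k ] (g i * c) ≡ ∑ k g * c
  ∑-*ʳ k c g = trans (∑-cong k (λ i → ℤP.*-comm (g i) c)) (trans (∑-*ˡ k c g) (ℤP.*-comm c _))

  ∑-affine : ∀ k c d (g : ℕ → ℤ) → ∑[ i < k ] (c * g i - d) ≡ c * ∑ k g - + k * d
  ∑-affine k c d g = trans (∑-distrib-sub k _ _) (cong₂ _-_ (∑-*ˡ k c g) (∑-const k d))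

  ∑-split : ∀ k l (g : ℕ → ℤ) → ∑ (k ℕ.+ l) g ≡ ∑ k g + ∑[ i < l ] g (k ℕ.+ i)
  ∑-split zero    l g = sym (ℤP.+-identityˡ _)
  ∑-split (suc k) l g = trans (cong (_+_ (g 0)) (∑-split k l _)) (sym (ℤP.+-assoc (g 0) _ _))

  ∑-last : ∀ k (g : ℕ → ℤ) → ∑ (suc k) g ≡ ∑ k g + g k
  ∑-last zero    g = ℤP.+-comm (g 0) 0ℤ
  ∑-last (suc k) g = trans (cong (_+_ (g 0)) (∑-last k _)) (sym (ℤP.+-assoc (g 0) _ _))

  ∑-comm : ∀ k l (f : ℕ → ℕ → ℤ) → ∑[ i < k ] ∑[ j < l ] f i j ≡ ∑[ j < l ] ∑[ i < k ] f i j
  ∑-comm zero    l f = sym (∑-zero l (λ _ _ → refl))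
  ∑-comm (suc k) l f = trans (cong (_+_ (∑ l (f 0))) (∑-comm k l _)) (sym (∑-distrib-+ l (f 0) _))

  ∑-product : ∀ k l (g h : ℕ → ℤ) → ∑[ i < k ] ∑[ j < l ] (g i * h j) ≡ ∑ k g * ∑ l h
  ∑-product k l g h = trans (∑-cong k (λ i → ∑-*ˡ l (g i) h)) (∑-*ʳ k (∑ l h) g)

  -- Alternating signs

  alt : ℕ → ℤ
  alt zero          = 1ℤ
  alt (suc zero)    = -1ℤ
  alt (suc (suc i)) = alt i

  alt-suc : ∀ i → alt (suc i) ≡ - alt i
  alt-suc zero          = refl
  alt-suc (suc zero)    = refl
  alt-suc (suc (suc i)) = alt-suc i

  alt-+ : ∀ i j → alt (i ℕ.+ j) ≡ alt i * alt j
  alt-+ zero          j = sym (ℤP.*-identityˡ (alt j))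
  alt-+ (suc zero)    j = trans (alt-suc j) (sym (ℤP.-1*i≡-i (alt j)))
  alt-+ (suc (suc i)) j = alt-+ i j

  alt-even : ∀ k → alt (k ℕ.* 2) ≡ 1ℤ
  alt-even zero    = refl
  alt-even (suc k) = alt-even k

  altℤ : ℤ → ℤ
  altℤ (+ i)      = alt i
  altℤ -[1+ i ]   = alt (suc i)

  altℤ-suc : ∀ x → altℤ (x + 1ℤ) ≡ - altℤ x
  altℤ-suc (+ i)          = trans (cong alt (ℕP.+-comm i 1)) (alt-suc i)
  altℤ-suc -[1+ zero ]    = refl
  altℤ-suc -[1+ suc i ]   = alt-suc i

  altℤ-+ : ∀ x j → altℤ (x + + j) ≡ altℤ x * alt j
  altℤ-+ x zero    = trans (cong altℤ (ℤP.+-identityʳ x)) (sym (ℤP.*-identityʳ (altℤ x)))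
  altℤ-+ x (suc j) = begin
    altℤ (x + + suc j)      ≡⟨ cong altℤ (trans (cong (_+_ x) (ℤP.+-comm 1ℤ (+ j))) (sym (ℤP.+-assoc x (+ j) 1ℤ))) ⟩
    altℤ (x + + j + 1ℤ)     ≡⟨ altℤ-suc (x + + j) ⟩
    - altℤ (x + + j)        ≡⟨ cong -_ (altℤ-+ x j) ⟩
    - (altℤ x * alt j)      ≡⟨ ℤP.neg-distribʳ-* (altℤ x) (alt j) ⟩
    altℤ x * - alt j        ≡⟨ cong (_*_ (altℤ x)) (sym (alt-suc j)) ⟩
    altℤ x * alt (suc j)    ∎

  ∑-alt-even : ∀ k → ∑ (k ℕ.* 2) alt ≡ 0ℤ
  ∑-alt-even zero    = refl
  ∑-alt-even (suc k) = cong (λ s → 1ℤ + (-1ℤ + s)) (∑-alt-even k)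

  ∑-alt-odd : ∀ k → ∑ (suc (k ℕ.* 2)) alt ≡ 1ℤ
  ∑-alt-odd k = trans (∑-last (k ℕ.* 2) alt) (cong₂ _+_ (∑-alt-even k) (alt-even k))

  ∑-alt-id-even : ∀ k → ∑[ i < k ℕ.* 2 ] (alt i * + i) ≡ - + k
  ∑-alt-id-even zero    = refl
  ∑-alt-id-even (suc k) = begin
    0ℤ + (-1ℤ + ∑[ i < k ℕ.* 2 ] (alt i * (+ 2 + + i)))
      ≡⟨ cong (λ s → 0ℤ + (-1ℤ + s)) (∑-cong (k ℕ.* 2) (λ i → ℤP.*-distribˡ-+ (alt i) (+ 2) (+ i))) ⟩
    0ℤ + (-1ℤ + ∑[ i < k ℕ.* 2 ] (alt i * + 2 + alt i * + i))
      ≡⟨ cong (λ s → 0ℤ + (-1ℤ + s)) (∑-distrib-+ (k ℕ.* 2) _ _) ⟩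
    0ℤ + (-1ℤ + (∑[ i < k ℕ.* 2 ] (alt i * + 2) + ∑[ i < k ℕ.* 2 ] (alt i * + i)))
      ≡⟨ cong₂ (λ s t → 0ℤ + (-1ℤ + (s + t))) (trans (∑-*ʳ (k ℕ.* 2) (+ 2) alt) (cong (_* + 2) (∑-alt-even k))) (∑-alt-id-even k) ⟩
    0ℤ + (-1ℤ + (0ℤ * + 2 + - + k))
      ≡⟨ simplify (+ k) ⟩
    - + suc k ∎
    where simplify : ∀ k → 0ℤ + (-1ℤ + (0ℤ * + 2 + - k)) ≡ - (1ℤ + k)
          simplify = solve-∀

  ∑-alt-id-odd : ∀ k → ∑[ i < suc (k ℕ.* 2) ] (alt i * + i) ≡ + k
  ∑-alt-id-odd k = begin
    ∑[ i < suc (k ℕ.* 2) ] (alt i * + i)            ≡⟨ ∑-last (k ℕ.* 2) (λ i → alt i * + i) ⟩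
    ∑[ i < k ℕ.* 2 ] (alt i * + i) + alt (k ℕ.* 2) * + (k ℕ.* 2)
      ≡⟨ cong₂ (λ s t → s + t * + (k ℕ.* 2)) (∑-alt-id-even k) (alt-even k) ⟩
    - + k + 1ℤ * + (k ℕ.* 2)                         ≡⟨ cong (λ t → - + k + 1ℤ * t) (ℤP.pos-* k 2) ⟩
    - + k + 1ℤ * (+ k * + 2)                         ≡⟨ simplify (+ k) ⟩
    + k                                              ∎
    where simplify : ∀ k → - k + 1ℤ * (k * + 2) ≡ k
          simplify = solve-∀

  ∑-altℤ : ∀ L e (E : ℕ → ℤ) → (∀ i → E i ≡ e + + i) → ∑[ i < L ] altℤ (E i) ≡ altℤ e * ∑ L alt
  ∑-altℤ L e E E≡ = trans (∑-cong L (λ i → trans (cong altℤ (E≡ i)) (altℤ-+ e i))) (∑-*ˡ L (altℤ e) alt)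

  ∑-altℤ-affine : ∀ k e u v (E C : ℕ → ℤ) → (∀ i → E i ≡ e + + i) → (∀ i → C i ≡ u + v * + i) →
    ∑[ i < suc (k ℕ.* 2) ] (altℤ (E i) * C i) ≡ altℤ e * (u + v * + k)
  ∑-altℤ-affine k e u v E C E≡ C≡ = begin
    ∑[ i < L ] (altℤ (E i) * C i)
      ≡⟨ ∑-cong L (λ i → trans (cong₂ _*_ (trans (cong altℤ (E≡ i)) (altℤ-+ e i)) (C≡ i))
                               (expand (altℤ e) (alt i) u v (+ i))) ⟩
    ∑[ i < L ] (altℤ e * u * alt i + altℤ e * v * (alt i * + i))
      ≡⟨ ∑-distrib-+ L (λ i → altℤ e * u * alt i) (λ i → altℤ e * v * (alt i * + i)) ⟩
    ∑[ i < L ] (altℤ e * u * alt i) + ∑[ i < L ] (altℤ e * v * (alt i * + i))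
      ≡⟨ cong₂ _+_ (trans (∑-*ˡ L (altℤ e * u) alt) (cong (_*_ (altℤ e * u)) (∑-alt-odd k)))
                   (trans (∑-*ˡ L (altℤ e * v) (λ i → alt i * + i)) (cong (_*_ (altℤ e * v)) (∑-alt-id-odd k))) ⟩
    altℤ e * u * 1ℤ + altℤ e * v * + k
      ≡⟨ collect (altℤ e) u v (+ k) ⟩
    altℤ e * (u + v * + k) ∎
    where
    L : ℕ
    L = suc (k ℕ.* 2)
    expand : ∀ s t u v i → s * t * (u + v * i) ≡ s * u * t + s * v * (t * i)
    expand = solve-∀
    collect : ∀ s u v k → s * u * 1ℤ + s * v * k ≡ s * (u + v * k)
    collect = solve-∀

  -- Intervals, rectangles and sums over a box

  window : ℕ → ℤ → ℤ
  window L d = indicator (⌊ 0ℤ ≤? d ⌋ ∧ ⌊ d <? + L ⌋)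

  window-in : ∀ {L i} → i ℕ.< L → window L (+ i) ≡ 1ℤ
  window-in {L} {i} i<L with + i <? + L
  ... | yes _    = refl
  ... | no  i≮L  = contradiction (ℤ.+<+ i<L) i≮L

  window-beyond : ∀ L i → window L (+ (L ℕ.+ i)) ≡ 0ℤ
  window-beyond L i with + (L ℕ.+ i) <? + L
  ... | yes L+i<L = contradiction (ℤP.drop‿+<+ L+i<L) (ℕP.≤⇒≯ (ℕP.m≤m+n L i))
  ... | no  _     = refl

  window-below : ∀ L i t → window L (+ i - + (suc i ℕ.+ t)) ≡ 0ℤ
  window-below L i t = cong (window L) (negate (+ i) (+ t))
    where negate : ∀ i t → i - (1ℤ + i + t) ≡ - (1ℤ + t)
          negate = solve-∀

  window-shift : ∀ L i j → window L (+ (i ℕ.+ j) - + i) ≡ window L (+ j)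
  window-shift L i j = cong (window L) (cancel (+ i) (+ j))
    where cancel : ∀ i j → i + j - i ≡ j
          cancel = solve-∀

  window-split : ∀ L₁ L₂ d → window (L₁ ℕ.+ L₂) d ≡ window L₁ d + window L₂ (d - + L₁)
  window-split L₁ L₂ -[1+ i ] = sym (trans (ℤP.+-identityˡ _) (cong (window L₂) (negate (+ suc i) (+ L₁))))
    where negate : ∀ a b → - a - b ≡ - (a + b)
          negate = solve-∀
  window-split L₁ L₂ (+ i) with ℕP.<-≤-connex i L₁
  ... | inj₁ i<L₁ with ℕP.m≤n⇒∃[o]m+o≡n i<L₁
  ...   | t , refl = begin
    window (suc i ℕ.+ t ℕ.+ L₂) (+ i)                              ≡⟨ window-in (ℕP.≤-trans i<L₁ (ℕP.m≤m+n _ L₂)) ⟩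
    1ℤ                                                             ≡⟨ sym (cong₂ _+_ (window-in i<L₁) (window-below L₂ i t)) ⟩
    window (suc i ℕ.+ t) (+ i) + window L₂ (+ i - + (suc i ℕ.+ t)) ∎
  window-split L₁ L₂ (+ i) | inj₂ L₁≤i with ℕP.m≤n⇒∃[o]m+o≡n L₁≤i
  ... | j , refl = begin
    window (L₁ ℕ.+ L₂) (+ (L₁ ℕ.+ j))                          ≡⟨ shifted j ⟩
    window L₂ (+ j)                                            ≡⟨ sym (ℤP.+-identityˡ _) ⟩
    0ℤ + window L₂ (+ j)                                       ≡⟨ sym (cong₂ _+_ (window-beyond L₁ j) (window-shift L₂ L₁ j)) ⟩
    window L₁ (+ (L₁ ℕ.+ j)) + window L₂ (+ (L₁ ℕ.+ j) - + L₁) ∎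
    where
    shifted : ∀ j → window (L₁ ℕ.+ L₂) (+ (L₁ ℕ.+ j)) ≡ window L₂ (+ j)
    shifted j with ℕP.<-≤-connex j L₂
    ... | inj₁ j<L₂ = trans (window-in (ℕP.+-monoʳ-< L₁ j<L₂)) (sym (window-in j<L₂))
    ... | inj₂ L₂≤j with ℕP.m≤n⇒∃[o]m+o≡n L₂≤j
    ...   | t , refl = trans (cong (λ w → window (L₁ ℕ.+ L₂) (+ w)) (sym (ℕP.+-assoc L₁ L₂ t)))
                             (trans (window-beyond (L₁ ℕ.+ L₂) t) (sym (window-beyond L₂ t)))

  window-empty : ∀ d → window 0 d ≡ 0ℤ
  window-empty (+ i)    = window-beyond 0 i
  window-empty -[1+ i ] = refl

  interval : ℤ → ℕ → ℤ → ℤ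
  interval b L y = window L (y - b)

  interval-split : ∀ b L₁ L₂ y → interval b (L₁ ℕ.+ L₂) y ≡ interval b L₁ y + interval (b + + L₁) L₂ y
  interval-split b L₁ L₂ y = trans (window-split L₁ L₂ (y - b)) (cong (λ d → window L₁ (y - b) + window L₂ d) (regroup y b (+ L₁)))
    where regroup : ∀ y b l → y - b - l ≡ y - (b + l)
          regroup = solve-∀

  interval-translate : ∀ b L y d → interval b L (y - d) ≡ interval (b + d) L y
  interval-translate b L y d = cong (window L) (regroup y d b)
    where regroup : ∀ y d b → y - d - b ≡ y - (b + d)
          regroup = solve-∀

  rect : ℤ → ℤ → ℕ → ℕ → Cell → ℤ
  rect a b p q (x , y) = interval a p x * interval b q y

  rect-split-width : ∀ a b p₁ p₂ q c → rect a b (p₁ ℕ.+ p₂) q c ≡ rect a b p₁ q c + rect (a + + p₁) b p₂ q c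
  rect-split-width a b p₁ p₂ q (x , y) =
    trans (cong (_* interval b q y) (interval-split a p₁ p₂ x)) (ℤP.*-distribʳ-+ (interval b q y) (interval a p₁ x) (interval (a + + p₁) p₂ x))

  rect-split-height : ∀ a b p q₁ q₂ c → rect a b p (q₁ ℕ.+ q₂) c ≡ rect a b p q₁ c + rect a (b + + q₁) p q₂ c
  rect-split-height a b p q₁ q₂ (x , y) =
    trans (cong (_*_ (interval a p x)) (interval-split b q₁ q₂ y)) (ℤP.*-distribˡ-+ (interval a p x) (interval b q₁ y) (interval (b + + q₁) q₂ y))

  rect-translate : ∀ a b p q dx dy x y → rect a b p q (x - dx , y - dy) ≡ rect (a + dx) (b + dy) p q (x , y)
  rect-translate a b p q dx dy x y = cong₂ _*_ (interval-translate a p x dx) (interval-translate b q y dy)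

  rect-transpose : ∀ a b p q x y → rect a b p q (y , x) ≡ rect b a q p (x , y)
  rect-transpose a b p q x y = ℤP.*-comm (interval a p y) (interval b q x)

  rect-empty-width : ∀ a b q c → rect a b 0 q c ≡ 0ℤ
  rect-empty-width a b q (x , y) = trans (cong (_* interval b q y) (window-empty (x - a))) (ℤP.*-zeroˡ (interval b q y))

  rect-empty-height : ∀ a b p c → rect a b p 0 c ≡ 0ℤ
  rect-empty-height a b p (x , y) = trans (cong (_*_ (interval a p x)) (window-empty (y - b))) (ℤP.*-zeroʳ (interval a p x))

  interval-offset : ∀ lo k L j → interval (lo + + k) L (lo + + j) ≡ window L (+ j - + k)
  interval-offset lo k L j = cong (window L) (cancel lo (+ j) (+ k))
    where cancel : ∀ lo j k → lo + j - (lo + k) ≡ j - k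
          cancel = solve-∀

  Fits : ℤ → ℕ → ℤ → ℕ → Set
  Fits lo W c L = ∃₂ λ k m → (c ≡ lo + + k) × (k ℕ.+ L ℕ.+ m ≡ W)

  ∑-window-interval : ∀ {lo W c L} → Fits lo W c L → (g : ℤ → ℤ) →
    ∑[ j < W ] (g (lo + + j) * interval c L (lo + + j)) ≡ ∑[ i < L ] g (c + + i)
  ∑-window-interval {lo} {L = L} (k , m , refl , refl) g = begin
    ∑[ j < k ℕ.+ L ℕ.+ m ] (g (lo + + j) * interval (lo + + k) L (lo + + j))
      ≡⟨ ∑-cong (k ℕ.+ L ℕ.+ m) (λ j → cong (_*_ (g (lo + + j))) (interval-offset lo k L j)) ⟩
    ∑ (k ℕ.+ L ℕ.+ m) G
      ≡⟨ trans (∑-split (k ℕ.+ L) m G) (cong (_+ ∑[ i < m ] G (k ℕ.+ L ℕ.+ i)) (∑-split k L G)) ⟩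
    ∑ k G + ∑[ i < L ] G (k ℕ.+ i) + ∑[ i < m ] G (k ℕ.+ L ℕ.+ i)
      ≡⟨ cong₂ (λ s t → s + ∑[ i < L ] G (k ℕ.+ i) + t) (∑-zero k before) (∑-zero m (λ i _ → after i)) ⟩
    0ℤ + ∑[ i < L ] G (k ℕ.+ i) + 0ℤ
      ≡⟨ trans (ℤP.+-identityʳ _) (trans (ℤP.+-identityˡ _) (∑-cong-< L inside)) ⟩
    ∑[ i < L ] g (lo + + k + + i) ∎
    where
    G : ℕ → ℤ
    G j = g (lo + + j) * window L (+ j - + k)
    before : ∀ j → j ℕ.< k → G j ≡ 0ℤ
    before j j<k with ℕP.m≤n⇒∃[o]m+o≡n j<k
    ... | t , refl = trans (cong (_*_ (g (lo + + j))) (window-below L j t)) (ℤP.*-zeroʳ (g (lo + + j)))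
    inside : ∀ i → i ℕ.< L → G (k ℕ.+ i) ≡ g (lo + + k + + i)
    inside i i<L = begin
      g (lo + + (k ℕ.+ i)) * window L (+ (k ℕ.+ i) - + k)
        ≡⟨ cong₂ _*_ (cong g (sym (ℤP.+-assoc lo (+ k) (+ i)))) (trans (window-shift L k i) (window-in i<L)) ⟩
      g (lo + + k + + i) * 1ℤ
        ≡⟨ ℤP.*-identityʳ (g (lo + + k + + i)) ⟩
      g (lo + + k + + i) ∎
    after : ∀ i → G (k ℕ.+ L ℕ.+ i) ≡ 0ℤ
    after i = begin
      g (lo + + (k ℕ.+ L ℕ.+ i)) * window L (+ (k ℕ.+ L ℕ.+ i) - + k)
        ≡⟨ cong (λ w → g (lo + + (k ℕ.+ L ℕ.+ i)) * window L (+ w - + k)) (ℕP.+-assoc k L i) ⟩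
      g (lo + + (k ℕ.+ L ℕ.+ i)) * window L (+ (k ℕ.+ (L ℕ.+ i)) - + k)
        ≡⟨ cong (_*_ (g (lo + + (k ℕ.+ L ℕ.+ i)))) (trans (window-shift L k (L ℕ.+ i)) (window-beyond L i)) ⟩
      g (lo + + (k ℕ.+ L ℕ.+ i)) * 0ℤ
        ≡⟨ ℤP.*-zeroʳ (g (lo + + (k ℕ.+ L ℕ.+ i))) ⟩
      0ℤ ∎

  rectSum : (Cell → ℤ) → ℤ → ℤ → ℕ → ℕ → ℤ
  rectSum f a b p q = ∑[ i < p ] ∑[ j < q ] f (a + + i , b + + j)

  boxSum : ℕ → (Cell → ℤ) → ℤ
  boxSum K f = ∑[ i < K ℕ.+ K ] ∑[ j < K ℕ.+ K ] f (- + K + + i , - + K + + j)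

  FitsBox : ℕ → ℤ → ℕ → Set
  FitsBox K = Fits (- + K) (K ℕ.+ K)

  boxSum-rect : ∀ K {a b p q} → FitsBox K a p → FitsBox K b q → (f : Cell → ℤ) →
    boxSum K (λ c → f c * rect a b p q c) ≡ rectSum f a b p q
  boxSum-rect K {a} {b} {p} {q} fa fb f = begin
    ∑[ i < K ℕ.+ K ] ∑[ j < K ℕ.+ K ] (f (X i , X j) * (interval a p (X i) * interval b q (X j)))
      ≡⟨ ∑-cong (K ℕ.+ K) (λ i → trans (∑-cong (K ℕ.+ K) (λ j → regroup (f (X i , X j)) _ _))
                                        (∑-*ʳ (K ℕ.+ K) (interval a p (X i)) _)) ⟩
    ∑[ i < K ℕ.+ K ] (∑[ j < K ℕ.+ K ] (f (X i , X j) * interval b q (X j)) * interval a p (X i))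
      ≡⟨ ∑-cong (K ℕ.+ K) (λ i → cong (_* interval a p (X i)) (∑-window-interval {lo = - + K} fb (λ y → f (X i , y)))) ⟩
    ∑[ i < K ℕ.+ K ] (∑[ j < q ] f (X i , b + + j) * interval a p (X i))
      ≡⟨ ∑-window-interval {lo = - + K} fa (λ x → ∑[ j < q ] f (x , b + + j)) ⟩
    rectSum f a b p q ∎
    where
    X : ℕ → ℤ
    X i = - + K + + i
    regroup : ∀ f u v → f * (u * v) ≡ f * v * u
    regroup = solve-∀

  bounded⇒fitsBox : ∀ {K} a d L → ∣ a ∣ ℕ.+ (d ℕ.+ L) ℕ.≤ K → FitsBox K (a + + d) L
  bounded⇒fitsBox (+ u) d L bound with ℕP.m≤n⇒∃[o]m+o≡n bound
  ... | r , refl = _ , r , corner (+ (u ℕ.+ (d ℕ.+ L) ℕ.+ r)) (+ u) (+ d) , width u d L r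
    where corner : ∀ K u d → u + d ≡ - K + (K + (u + d))
          corner = solve-∀
          width : ∀ u d L r → let K = u ℕ.+ (d ℕ.+ L) ℕ.+ r in K ℕ.+ (u ℕ.+ d) ℕ.+ L ℕ.+ r ≡ K ℕ.+ K
          width = solveℕ-∀
  bounded⇒fitsBox -[1+ u ] d L bound with ℕP.m≤n⇒∃[o]m+o≡n bound
  ... | r , refl = d ℕ.+ L ℕ.+ r ℕ.+ d , suc u ℕ.+ suc u ℕ.+ r , corner (+ u) (+ d) (+ L) (+ r) , width u d L r
    where corner : ∀ u d L r → - (1ℤ + u) + d ≡ - (1ℤ + u + (d + L) + r) + (d + L + r + d)
          corner = solve-∀
          width : ∀ u d L r → let K = suc u ℕ.+ (d ℕ.+ L) ℕ.+ r in d ℕ.+ L ℕ.+ r ℕ.+ d ℕ.+ L ℕ.+ (suc u ℕ.+ suc u ℕ.+ r) ≡ K ℕ.+ K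
          width = solveℕ-∀

  rectSum-column : ∀ f a b q → rectSum f a b 1 q ≡ ∑[ j < q ] f (a , b + + j)
  rectSum-column f a b q = trans (ℤP.+-identityʳ _) (∑-cong q (λ j → cong (λ x → f (x , b + + j)) (ℤP.+-identityʳ a)))

  rectSum-row : ∀ f a b p → rectSum f a b p 1 ≡ ∑[ i < p ] f (a + + i , b)
  rectSum-row f a b p = ∑-cong p (λ i → trans (ℤP.+-identityʳ _) (cong (λ y → f (a + + i , y)) (ℤP.+-identityʳ b)))

  rectSum-cell : ∀ f a b → rectSum f a b 1 1 ≡ f (a , b)
  rectSum-cell f a b = trans (rectSum-column f a b 1) (trans (ℤP.+-identityʳ _) (cong (λ y → f (a , y)) (ℤP.+-identityʳ b)))

  boxSum-cong : ∀ K {f g : Cell → ℤ} → (∀ c → f c ≡ g c) → boxSum K f ≡ boxSum K g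
  boxSum-cong K eq = ∑-cong (K ℕ.+ K) (λ i → ∑-cong (K ℕ.+ K) (λ j → eq _))

  boxSum-+ : ∀ K (f g : Cell → ℤ) → boxSum K (λ c → f c + g c) ≡ boxSum K f + boxSum K g
  boxSum-+ K f g = trans (∑-cong (K ℕ.+ K) (λ i → ∑-distrib-+ (K ℕ.+ K) _ _)) (∑-distrib-+ (K ℕ.+ K) _ _)

  boxSum-*ˡ : ∀ K c (f : Cell → ℤ) → boxSum K (λ x → c * f x) ≡ c * boxSum K f
  boxSum-*ˡ K c f = trans (∑-cong (K ℕ.+ K) (λ i → ∑-*ˡ (K ℕ.+ K) c _)) (∑-*ˡ (K ℕ.+ K) c _)

  boxSum-rect+rect : ∀ K {a b p q a′ b′ p′ q′} {g : Cell → ℤ} →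
    FitsBox K a p → FitsBox K b q → FitsBox K a′ p′ → FitsBox K b′ q′ →
    (∀ c → g c ≡ rect a b p q c + rect a′ b′ p′ q′ c) → (f : Cell → ℤ) →
    boxSum K (λ c → f c * g c) ≡ rectSum f a b p q + rectSum f a′ b′ p′ q′
  boxSum-rect+rect K {a} {b} {p} {q} {a′} {b′} {p′} {q′} {g} fa fb fa′ fb′ g≡ f = begin
    boxSum K (λ c → f c * g c)
      ≡⟨ boxSum-cong K (λ c → trans (cong (_*_ (f c)) (g≡ c)) (ℤP.*-distribˡ-+ (f c) (rect a b p q c) (rect a′ b′ p′ q′ c))) ⟩
    boxSum K (λ c → f c * rect a b p q c + f c * rect a′ b′ p′ q′ c)
      ≡⟨ boxSum-+ K (λ c → f c * rect a b p q c) (λ c → f c * rect a′ b′ p′ q′ c) ⟩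
    boxSum K (λ c → f c * rect a b p q c) + boxSum K (λ c → f c * rect a′ b′ p′ q′ c)
      ≡⟨ cong₂ _+_ (boxSum-rect K fa fb f) (boxSum-rect K fa′ fb′ f) ⟩
    rectSum f a b p q + rectSum f a′ b′ p′ q′ ∎

  -- Tiles as sums of two rectangles

  indicator-∧ : ∀ u v → indicator (u ∧ v) ≡ indicator u * indicator v
  indicator-∧ true  v = sym (ℤP.*-identityˡ _)
  indicator-∧ false v = refl

  indicator-∨ : ∀ u v → (u ≡ true → v ≡ false) → indicator (u ∨ v) ≡ indicator u + indicator v
  indicator-∨ true  v disjoint rewrite disjoint refl = refl
  indicator-∨ false v disjoint = sym (ℤP.+-identityˡ _)

  ==-true : ∀ {d c} → (d == c) ≡ true → d ≡ c
  ==-true {d} {c} eq with d ≟ c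
  ... | yes d≡c = d≡c

  ==-false : ∀ {d c} → ¬ d ≡ c → (d == c) ≡ false
  ==-false {d} {c} d≢c with d ≟ c
  ... | yes d≡c = contradiction d≡c d≢c
  ... | no  _   = refl

  window-1-nonzero : ∀ {d} → ¬ d ≡ 0ℤ → window 1 d ≡ 0ℤ
  window-1-nonzero {d} d≢0 with 0ℤ ≤? d | d <? 1ℤ
  ... | yes (ℤ.+≤+ z≤n) | yes (ℤ.+<+ (s≤s z≤n)) = contradiction refl d≢0
  ... | yes _ | no _ = refl
  ... | no  _ | _    = refl

  indicator-== : ∀ y b c → indicator ((y - b) == c) ≡ interval (b + c) 1 y
  indicator-== y b c with (y - b) ≟ c
  ... | yes refl = cong (window 1) (sym (cancel y b))
    where cancel : ∀ y b → y - (b + (y - b)) ≡ 0ℤ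
          cancel = solve-∀
  ... | no  y-b≢c = sym (window-1-nonzero (λ eq → y-b≢c (apart y b c eq)))
    where apart : ∀ y b c → y - (b + c) ≡ 0ℤ → y - b ≡ c
          apart y b c eq = trans (sym (shift y b c)) (trans (cong (_+ c) eq) (ℤP.+-identityˡ c))
            where shift : ∀ y b c → y - (b + c) + c ≡ y - b
                  shift = solve-∀

  indicator-==0 : ∀ y b → indicator ((y - b) == 0ℤ) ≡ interval b 1 y
  indicator-==0 y b = trans (indicator-== y b 0ℤ) (cong (λ b′ → interval b′ 1 y) (ℤP.+-identityʳ b))

  indicator-inRange : ∀ m d → indicator (inRange 0ℤ (+ m) d) ≡ window (suc m) d
  indicator-inRange m d = cong (λ t → indicator (⌊ 0ℤ ≤? d ⌋ ∧ t))
    (trans (isYes≗does (d ≤? + m))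
      (trans (does-⇔ (mk⇔ ℤP.i≤pred[j]⇒i<j ℤP.i<j⇒i≤pred[j]) (d ≤? + m) (d <? + suc m))
             (sym (isYes≗does (d <? + suc m)))))

  ∧-true-left : ∀ {u v} → (u ∧ v) ≡ true → u ≡ true
  ∧-true-left {true} _ = refl

  ==-clash : ∀ {d c₁ c₂ u} → ¬ c₁ ≡ c₂ → ((d == c₁) ∧ u) ≡ true → (d == c₂) ≡ false
  ==-clash c₁≢c₂ h = ==-false (λ d≡c₂ → c₁≢c₂ (trans (sym (==-true (∧-true-left h))) d≡c₂))

  inRect-rect : ∀ p q c → indicator (inRect p q c) ≡ rect 0ℤ 0ℤ p q c
  inRect-rect p q (x , y) = begin
    indicator (inRect p q (x , y))       ≡⟨ cong indicator (sym (BoolP.∧-assoc ⌊ 0ℤ ≤? x ⌋ ⌊ x <? + p ⌋ (A y q))) ⟩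
    indicator (A x p ∧ A y q)            ≡⟨ indicator-∧ (A x p) (A y q) ⟩
    window p x * window q y              ≡⟨ cong₂ (λ u v → window p u * window q v) (sym (ℤP.+-identityʳ x)) (sym (ℤP.+-identityʳ y)) ⟩
    rect 0ℤ 0ℤ p q (x , y)               ∎
    where A : ℤ → ℕ → Bool
          A z r = ⌊ 0ℤ ≤? z ⌋ ∧ ⌊ z <? + r ⌋

  if-indicator : ∀ u s → (if u then s else 0ℤ) ≡ s * indicator u
  if-indicator true  s = sym (ℤP.*-identityʳ s)
  if-indicator false s = sym (ℤP.*-zeroʳ s)

  -- Tiles have n = m + 2 cells: in this form the offset + n - + 2 of Defs computes to + m.
  module Tiles (m : ℕ) where

    tile : Fin 4 → ℤ → ℤ → Cell → ℤ
    tile s a b (x , y) = indicator (inShape (suc (suc m)) s (x - a , y - b))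

    tile₀-rects : ∀ a b c → tile zero a b c ≡ rect a b 1 (suc m) c + rect (a + 1ℤ) b 1 1 c
    tile₀-rects a b (x , y) = trans
      (indicator-∨ (A ∧ B) (C ∧ D) (λ h → cong (_∧ D) (==-clash (λ ()) h)))
      (cong₂ _+_ (trans (indicator-∧ A B) (cong₂ _*_ (indicator-==0 x a) (indicator-inRange m (y - b))))
                 (trans (indicator-∧ C D) (cong₂ _*_ (indicator-== x a 1ℤ) (indicator-==0 y b))))
      where A B C D : Bool
            A = (x - a) == 0ℤ
            B = inRange 0ℤ (+ m) (y - b)
            C = (x - a) == 1ℤ
            D = (y - b) == 0ℤ

    tile₁-rects : ∀ a b c → tile (suc zero) a b c ≡ rect (a + 1ℤ) b 1 (suc m) c + rect a (b + + m) 1 1 c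
    tile₁-rects a b (x , y) = trans
      (indicator-∨ (A ∧ B) (C ∧ D) (λ h → cong (_∧ D) (==-clash (λ ()) h)))
      (cong₂ _+_ (trans (indicator-∧ A B) (cong₂ _*_ (indicator-== x a 1ℤ) (indicator-inRange m (y - b))))
                 (trans (indicator-∧ C D) (cong₂ _*_ (indicator-==0 x a) (indicator-== y b (+ m)))))
      where A B C D : Bool
            A = (x - a) == 1ℤ
            B = inRange 0ℤ (+ m) (y - b)
            C = (x - a) == 0ℤ
            D = (y - b) == (+ m)

    tile₂-rects : ∀ a b c → tile (suc (suc zero)) a b c ≡ rect a b (suc m) 1 c + rect a (b + 1ℤ) 1 1 c
    tile₂-rects a b (x , y) = trans
      (indicator-∨ (A ∧ B) (C ∧ D) (λ h → trans (cong (C ∧_) (==-clash (λ ()) h)) (BoolP.∧-zeroʳ C)))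
      (cong₂ _+_ (trans (indicator-∧ A B) (trans (ℤP.*-comm (indicator A) (indicator B))
                   (cong₂ _*_ (indicator-inRange m (x - a)) (indicator-==0 y b))))
                 (trans (indicator-∧ C D) (cong₂ _*_ (indicator-==0 x a) (indicator-== y b 1ℤ))))
      where A B C D : Bool
            A = (y - b) == 0ℤ
            B = inRange 0ℤ (+ m) (x - a)
            C = (x - a) == 0ℤ
            D = (y - b) == 1ℤ

    tile₃-rects : ∀ a b c → tile (suc (suc (suc zero))) a b c ≡ rect a (b + 1ℤ) (suc m) 1 c + rect (a + + m) b 1 1 c
    tile₃-rects a b (x , y) = trans
      (indicator-∨ (A ∧ B) (C ∧ D) (λ h → trans (cong (C ∧_) (==-clash (λ ()) h)) (BoolP.∧-zeroʳ C)))
      (cong₂ _+_ (trans (indicator-∧ A B) (trans (ℤP.*-comm (indicator A) (indicator B))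
                   (cong₂ _*_ (indicator-inRange m (x - a)) (indicator-== y b 1ℤ))))
                 (trans (indicator-∧ C D) (cong₂ _*_ (indicator-== x a (+ m)) (indicator-==0 y b))))
      where A B C D : Bool
            A = (y - b) == 1ℤ
            B = inRange 0ℤ (+ m) (x - a)
            C = (x - a) == (+ m)
            D = (y - b) == 0ℤ

    tileSum : (Cell → ℤ) → Fin 4 → ℤ → ℤ → ℤ
    tileSum f zero                   a b = ∑[ j < suc m ] f (a , b + + j) + f (a + 1ℤ , b)
    tileSum f (suc zero)             a b = ∑[ j < suc m ] f (a + 1ℤ , b + + j) + f (a , b + + m)
    tileSum f (suc (suc zero))       a b = ∑[ i < suc m ] f (a + + i , b) + f (a , b + 1ℤ)
    tileSum f (suc (suc (suc zero))) a b = ∑[ i < suc m ] f (a + + i , b + 1ℤ) + f (a + + m , b)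

    private
      fits : ∀ {K} a d L → d ℕ.+ L ℕ.≤ suc (suc m) → ∣ a ∣ ℕ.+ suc (suc m) ℕ.≤ K → FitsBox K (a + + d) L
      fits a d L dL aK = bounded⇒fitsBox a d L (ℕP.≤-trans (ℕP.+-monoʳ-≤ ∣ a ∣ dL) aK)

      fits₀ : ∀ {K} a L → L ℕ.≤ suc (suc m) → ∣ a ∣ ℕ.+ suc (suc m) ℕ.≤ K → FitsBox K a L
      fits₀ {K} a L L≤n aK = subst (λ c → FitsBox K c L) (ℤP.+-identityʳ a) (fits a 0 L L≤n aK)

      1≤n : 1 ℕ.≤ suc (suc m)
      1≤n = s≤s z≤n

      2≤n : 1 ℕ.+ 1 ℕ.≤ suc (suc m)
      2≤n = s≤s (s≤s z≤n)

      m+1≤n : m ℕ.+ 1 ℕ.≤ suc (suc m)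
      m+1≤n = ℕP.≤-trans (ℕP.≤-reflexive (ℕP.+-comm m 1)) (ℕP.n≤1+n _)

      n-1≤n : suc m ℕ.≤ suc (suc m)
      n-1≤n = ℕP.n≤1+n _

    boxSum-tile : ∀ K s a b → ∣ a ∣ ℕ.+ suc (suc m) ℕ.≤ K → ∣ b ∣ ℕ.+ suc (suc m) ℕ.≤ K → (f : Cell → ℤ) →
      boxSum K (λ c → f c * tile s a b c) ≡ tileSum f s a b
    boxSum-tile K zero a b aK bK f =
      trans (boxSum-rect+rect K (fits₀ a 1 1≤n aK) (fits₀ b (suc m) n-1≤n bK) (fits a 1 1 2≤n aK) (fits₀ b 1 1≤n bK) (tile₀-rects a b) f)
            (cong₂ _+_ (rectSum-column f a b (suc m)) (rectSum-cell f (a + 1ℤ) b))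
    boxSum-tile K (suc zero) a b aK bK f =
      trans (boxSum-rect+rect K (fits a 1 1 2≤n aK) (fits₀ b (suc m) n-1≤n bK) (fits₀ a 1 1≤n aK) (fits b m 1 m+1≤n bK) (tile₁-rects a b) f)
            (cong₂ _+_ (rectSum-column f (a + 1ℤ) b (suc m)) (rectSum-cell f a (b + + m)))
    boxSum-tile K (suc (suc zero)) a b aK bK f =
      trans (boxSum-rect+rect K (fits₀ a (suc m) n-1≤n aK) (fits₀ b 1 1≤n bK) (fits₀ a 1 1≤n aK) (fits b 1 1 2≤n bK) (tile₂-rects a b) f)
            (cong₂ _+_ (rectSum-row f a b (suc m)) (rectSum-cell f a (b + 1ℤ)))
    boxSum-tile K (suc (suc (suc zero))) a b aK bK f =
      trans (boxSum-rect+rect K (fits₀ a (suc m) n-1≤n aK) (fits b 1 1 2≤n bK) (fits a m 1 m+1≤n aK) (fits₀ b 1 1≤n bK) (tile₃-rects a b) f)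
            (cong₂ _+_ (rectSum-row f a (b + 1ℤ) (suc m)) (rectSum-cell f (a + + m) b))

    extent : List PlacedTile → ℕ
    extent []                          = 0
    extent (placed _ (a , b) _ ∷ ts) = (∣ a ∣ ℕ.+ suc (suc m)) ℕ.+ (∣ b ∣ ℕ.+ suc (suc m)) ℕ.+ extent ts

    boxSum-coverage : ∀ K (f : Cell → ℤ) M → (∀ s a b → M ∣ tileSum f s a b) →
      ∀ ts → extent ts ℕ.≤ K → M ∣ boxSum K (λ c → f c * coverage (suc (suc m)) ts c)
    boxSum-coverage K f M tile∣ [] _ =
      divides 0ℤ (trans (boxSum-cong K (λ c → ℤP.*-zeroʳ (f c))) (∑-zero (K ℕ.+ K) (λ _ _ → ∑-zero (K ℕ.+ K) (λ _ _ → refl))))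
    boxSum-coverage K f M tile∣ (placed s (a , b) w ∷ ts) bound =
      subst (M ∣_) (sym split) (∣m∣n⇒∣m+n (∣n⇒∣m*n (signToℤ w) (subst (M ∣_) (sym (boxSum-tile K s a b aK bK f)) (tile∣ s a b)))
                                            (boxSum-coverage K f M tile∣ ts rest))
      where
      aK : ∣ a ∣ ℕ.+ suc (suc m) ℕ.≤ K
      aK = ℕP.≤-trans (ℕP.≤-trans (ℕP.m≤m+n _ _) (ℕP.m≤m+n _ _)) bound
      bK : ∣ b ∣ ℕ.+ suc (suc m) ℕ.≤ K
      bK = ℕP.≤-trans (ℕP.≤-trans (ℕP.m≤n+m _ (∣ a ∣ ℕ.+ suc (suc m))) (ℕP.m≤m+n _ _)) bound
      rest : extent ts ℕ.≤ K
      rest = ℕP.≤-trans (ℕP.m≤n+m _ _) bound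
      split : boxSum K (λ c → f c * coverage (suc (suc m)) (placed s (a , b) w ∷ ts) c)
            ≡ signToℤ w * boxSum K (λ c → f c * tile s a b c) + boxSum K (λ c → f c * coverage (suc (suc m)) ts c)
      split = begin
        boxSum K (λ c → f c * (contrib (suc (suc m)) (placed s (a , b) w) c + coverage (suc (suc m)) ts c))
          ≡⟨ boxSum-cong K (λ c → trans (ℤP.*-distribˡ-+ (f c) _ _)
                                         (cong (_+ f c * coverage (suc (suc m)) ts c) (swap c))) ⟩
        boxSum K (λ c → signToℤ w * (f c * tile s a b c) + f c * coverage (suc (suc m)) ts c)
          ≡⟨ boxSum-+ K (λ c → signToℤ w * (f c * tile s a b c)) (λ c → f c * coverage (suc (suc m)) ts c) ⟩
        boxSum K (λ c → signToℤ w * (f c * tile s a b c)) + boxSum K (λ c → f c * coverage (suc (suc m)) ts c)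
          ≡⟨ cong (_+ boxSum K (λ c → f c * coverage (suc (suc m)) ts c)) (boxSum-*ˡ K (signToℤ w) (λ c → f c * tile s a b c)) ⟩
        signToℤ w * boxSum K (λ c → f c * tile s a b c) + boxSum K (λ c → f c * coverage (suc (suc m)) ts c) ∎
        where
        rearrange : ∀ f w t → f * (w * t) ≡ w * (f * t)
        rearrange = solve-∀
        swap : ∀ c → f c * contrib (suc (suc m)) (placed s (a , b) w) c ≡ signToℤ w * (f c * tile s a b c)
        swap c = trans (cong (_*_ (f c)) (if-indicator _ (signToℤ w))) (rearrange (f c) (signToℤ w) (tile s a b c))

    signedTiling-invariant : (f : Cell → ℤ) (M : ℤ) → (∀ s a b → M ∣ tileSum f s a b) →
      ∀ {p q} → SignedTileable (suc (suc m)) p q → M ∣ rectSum f 0ℤ 0ℤ p q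
    signedTiling-invariant f M tile∣ {p} {q} (tiling ts covers) =
      subst (M ∣_) box≡rect (boxSum-coverage K f M tile∣ ts (ℕP.m≤m+n _ _))
      where
      K : ℕ
      K = extent ts ℕ.+ (p ℕ.+ q)
      box≡rect : boxSum K (λ c → f c * coverage (suc (suc m)) ts c) ≡ rectSum f 0ℤ 0ℤ p q
      box≡rect = trans (boxSum-cong K (λ c → cong (_*_ (f c)) (trans (covers c) (inRect-rect p q c))))
                       (boxSum-rect K (bounded⇒fitsBox {K} (+ 0) 0 p p≤K) (bounded⇒fitsBox {K} (+ 0) 0 q q≤K) f)
        where p≤K : p ℕ.≤ K
              p≤K = ℕP.≤-trans (ℕP.m≤m+n p q) (ℕP.m≤n+m (p ℕ.+ q) (extent ts))
              q≤K : q ℕ.≤ K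
              q≤K = ℕP.≤-trans (ℕP.m≤n+m q p) (ℕP.m≤n+m (p ℕ.+ q) (extent ts))

  -- Three invariants

  checker : Cell → ℤ
  checker (x , y) = altℤ (x + y)

  -- With n = 2k + 2, its sum over a vertical tile is 0 and over a horizontal one ±(k² − 1).
  torsion : ℕ → Cell → ℤ
  torsion k (x , y) = altℤ (x + y) * (+ k * x + y)

  module Invariants (k : ℕ) where
    open Tiles (k ℕ.* 2)

    private
      σ : ℤ → ℤ → ℤ
      σ a b = altℤ (a + b)

      σ-column : ∀ a b → ∑[ j < suc (k ℕ.* 2) ] altℤ (a + (b + + j)) ≡ σ a b
      σ-column a b = trans (∑-altℤ (suc (k ℕ.* 2)) (a + b) (λ j → a + (b + + j)) (λ j → sym (ℤP.+-assoc a b (+ j))))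
                           (trans (cong (_*_ (σ a b)) (∑-alt-odd k)) (ℤP.*-identityʳ _))

      σ-row : ∀ a b → ∑[ i < suc (k ℕ.* 2) ] altℤ (a + + i + b) ≡ σ a b
      σ-row a b = trans (∑-altℤ (suc (k ℕ.* 2)) (a + b) (λ i → a + + i + b) (λ i → swap a b (+ i)))
                        (trans (cong (_*_ (σ a b)) (∑-alt-odd k)) (ℤP.*-identityʳ _))
        where swap : ∀ a b i → a + i + b ≡ a + b + i
              swap = solve-∀

      σ-suc : ∀ a b e → e ≡ a + b + 1ℤ → altℤ e ≡ - σ a b
      σ-suc a b e refl = altℤ-suc (a + b)

      σ-far : ∀ a b e → e ≡ a + b + + (k ℕ.* 2) → altℤ e ≡ σ a b
      σ-far a b e refl = trans (altℤ-+ (a + b) (k ℕ.* 2)) (trans (cong (_*_ (σ a b)) (alt-even k)) (ℤP.*-identityʳ _))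

    checker-tileSum : ∀ s a b → tileSum checker s a b ≡ 0ℤ
    checker-tileSum zero a b =
      trans (cong₂ _+_ (σ-column a b) (σ-suc a b _ (shuffle a b))) (ℤP.+-inverseʳ (σ a b))
      where shuffle : ∀ a b → a + 1ℤ + b ≡ a + b + 1ℤ
            shuffle = solve-∀
    checker-tileSum (suc zero) a b =
      trans (cong₂ _+_ (trans (σ-column (a + 1ℤ) b) (σ-suc a b _ (shuffle a b))) (σ-far a b _ (sym (ℤP.+-assoc a b _))))
            (ℤP.+-inverseˡ (σ a b))
      where shuffle : ∀ a b → a + 1ℤ + b ≡ a + b + 1ℤ
            shuffle = solve-∀
    checker-tileSum (suc (suc zero)) a b =
      trans (cong₂ _+_ (σ-row a b) (σ-suc a b _ (sym (ℤP.+-assoc a b 1ℤ)))) (ℤP.+-inverseʳ (σ a b))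
    checker-tileSum (suc (suc (suc zero))) a b =
      trans (cong₂ _+_ (trans (σ-row a (b + 1ℤ)) (σ-suc a b _ (sym (ℤP.+-assoc a b 1ℤ)))) (σ-far a b _ (swap a b _)))
            (ℤP.+-inverseˡ (σ a b))
      where swap : ∀ a b i → a + i + b ≡ a + b + i
            swap = solve-∀

    rectSum-checker-odd : ∀ l r → rectSum checker 0ℤ 0ℤ (suc (l ℕ.* 2)) (suc (r ℕ.* 2)) ≡ 1ℤ
    rectSum-checker-odd l r = begin
      ∑[ i < suc (l ℕ.* 2) ] ∑[ j < suc (r ℕ.* 2) ] alt (i ℕ.+ j)
        ≡⟨ ∑-cong (suc (l ℕ.* 2)) (λ i → ∑-cong (suc (r ℕ.* 2)) (λ j → alt-+ i j)) ⟩
      ∑[ i < suc (l ℕ.* 2) ] ∑[ j < suc (r ℕ.* 2) ] (alt i * alt j)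
        ≡⟨ ∑-product (suc (l ℕ.* 2)) (suc (r ℕ.* 2)) alt alt ⟩
      ∑ (suc (l ℕ.* 2)) alt * ∑ (suc (r ℕ.* 2)) alt
        ≡⟨ cong₂ _*_ (∑-alt-odd l) (∑-alt-odd r) ⟩
      1ℤ ∎

    odd×odd-not-tileable : ∀ l r → ¬ SignedTileable (suc k ℕ.* 2) (suc (l ℕ.* 2)) (suc (r ℕ.* 2))
    odd×odd-not-tileable l r tiled = contradiction (trans (sym (rectSum-checker-odd l r)) sum≡0) λ ()
      where sum≡0 : rectSum checker 0ℤ 0ℤ (suc (l ℕ.* 2)) (suc (r ℕ.* 2)) ≡ 0ℤ
            sum≡0 = 0∣⇒≡0 (signedTiling-invariant checker 0ℤ (λ s a b → divides 0ℤ (checker-tileSum s a b)) tiled)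

    torsion-tileSum : ∀ s a b → (+ k + 1ℤ) * (+ k - 1ℤ) ∣ tileSum (torsion k) s a b
    torsion-tileSum zero a b = divides 0ℤ (begin
      ∑[ j < suc (k ℕ.* 2) ] (altℤ (a + (b + + j)) * (+ k * a + (b + + j))) + altℤ (a + 1ℤ + b) * (+ k * (a + 1ℤ) + b)
        ≡⟨ cong₂ _+_ (∑-altℤ-affine k (a + b) (+ k * a + b) 1ℤ _ _ (λ j → sym (ℤP.+-assoc a b (+ j))) (λ j → shift (+ k * a) b (+ j)))
                     (cong (_* (+ k * (a + 1ℤ) + b)) (σ-suc a b _ (shuffle a b))) ⟩
      σ a b * (+ k * a + b + 1ℤ * + k) + - σ a b * (+ k * (a + 1ℤ) + b)
        ≡⟨ vanish (σ a b) (+ k) a b ⟩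
      0ℤ * ((+ k + 1ℤ) * (+ k - 1ℤ)) ∎)
      where shift : ∀ u b j → u + (b + j) ≡ u + b + 1ℤ * j
            shift = solve-∀
            shuffle : ∀ a b → a + 1ℤ + b ≡ a + b + 1ℤ
            shuffle = solve-∀
            vanish : ∀ s k a b → s * (k * a + b + 1ℤ * k) + - s * (k * (a + 1ℤ) + b) ≡ 0ℤ * ((k + 1ℤ) * (k - 1ℤ))
            vanish = solve-∀
    torsion-tileSum (suc zero) a b = divides 0ℤ (begin
      ∑[ j < suc (k ℕ.* 2) ] (altℤ (a + 1ℤ + (b + + j)) * (+ k * (a + 1ℤ) + (b + + j)))
        + altℤ (a + (b + + (k ℕ.* 2))) * (+ k * a + (b + + (k ℕ.* 2)))
        ≡⟨ cong₂ _+_ (∑-altℤ-affine k (a + b + 1ℤ) (+ k * (a + 1ℤ) + b) 1ℤ _ _ (λ j → shuffle a b (+ j)) (λ j → shift (+ k * (a + 1ℤ)) b (+ j)))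
                     (cong₂ _*_ (σ-far a b _ (sym (ℤP.+-assoc a b _))) (cong (λ t → + k * a + (b + t)) (ℤP.pos-* k 2))) ⟩
      altℤ (a + b + 1ℤ) * (+ k * (a + 1ℤ) + b + 1ℤ * + k) + σ a b * (+ k * a + (b + + k * + 2))
        ≡⟨ cong (λ t → t * (+ k * (a + 1ℤ) + b + 1ℤ * + k) + σ a b * (+ k * a + (b + + k * + 2))) (altℤ-suc (a + b)) ⟩
      - σ a b * (+ k * (a + 1ℤ) + b + 1ℤ * + k) + σ a b * (+ k * a + (b + + k * + 2))
        ≡⟨ vanish (σ a b) (+ k) a b ⟩
      0ℤ * ((+ k + 1ℤ) * (+ k - 1ℤ)) ∎)
      where shift : ∀ u b j → u + (b + j) ≡ u + b + 1ℤ * j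
            shift = solve-∀
            shuffle : ∀ a b j → a + 1ℤ + (b + j) ≡ a + b + 1ℤ + j
            shuffle = solve-∀
            vanish : ∀ s k a b → - s * (k * (a + 1ℤ) + b + 1ℤ * k) + s * (k * a + (b + k * + 2)) ≡ 0ℤ * ((k + 1ℤ) * (k - 1ℤ))
            vanish = solve-∀
    torsion-tileSum (suc (suc zero)) a b = divides (σ a b) (begin
      ∑[ i < suc (k ℕ.* 2) ] (altℤ (a + + i + b) * (+ k * (a + + i) + b)) + altℤ (a + (b + 1ℤ)) * (+ k * a + (b + 1ℤ))
        ≡⟨ cong₂ _+_ (∑-altℤ-affine k (a + b) (+ k * a + b) (+ k) _ _ (λ i → swap a b (+ i)) (λ i → spread (+ k) a b (+ i)))
                     (cong (_* (+ k * a + (b + 1ℤ))) (σ-suc a b _ (sym (ℤP.+-assoc a b 1ℤ)))) ⟩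
      σ a b * (+ k * a + b + + k * + k) + - σ a b * (+ k * a + (b + 1ℤ))
        ≡⟨ factor (σ a b) (+ k) a b ⟩
      σ a b * ((+ k + 1ℤ) * (+ k - 1ℤ)) ∎)
      where swap : ∀ a b i → a + i + b ≡ a + b + i
            swap = solve-∀
            spread : ∀ k a b i → k * (a + i) + b ≡ k * a + b + k * i
            spread = solve-∀
            factor : ∀ s k a b → s * (k * a + b + k * k) + - s * (k * a + (b + 1ℤ)) ≡ s * ((k + 1ℤ) * (k - 1ℤ))
            factor = solve-∀
    torsion-tileSum (suc (suc (suc zero))) a b = divides (σ a b) (begin
      ∑[ i < suc (k ℕ.* 2) ] (altℤ (a + + i + (b + 1ℤ)) * (+ k * (a + + i) + (b + 1ℤ)))
        + altℤ (a + + (k ℕ.* 2) + b) * (+ k * (a + + (k ℕ.* 2)) + b)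
        ≡⟨ cong₂ _+_ (∑-altℤ-affine k (a + b + 1ℤ) (+ k * a + (b + 1ℤ)) (+ k) _ _ (λ i → swap a b (+ i)) (λ i → spread (+ k) a (b + 1ℤ) (+ i)))
                     (cong₂ _*_ (σ-far a b _ (swap′ a b _)) (cong (λ t → + k * (a + t) + b) (ℤP.pos-* k 2))) ⟩
      altℤ (a + b + 1ℤ) * (+ k * a + (b + 1ℤ) + + k * + k) + σ a b * (+ k * (a + + k * + 2) + b)
        ≡⟨ cong (λ t → t * (+ k * a + (b + 1ℤ) + + k * + k) + σ a b * (+ k * (a + + k * + 2) + b)) (altℤ-suc (a + b)) ⟩
      - σ a b * (+ k * a + (b + 1ℤ) + + k * + k) + σ a b * (+ k * (a + + k * + 2) + b)
        ≡⟨ factor (σ a b) (+ k) a b ⟩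
      σ a b * ((+ k + 1ℤ) * (+ k - 1ℤ)) ∎)
      where swap : ∀ a b i → a + i + (b + 1ℤ) ≡ a + b + 1ℤ + i
            swap = solve-∀
            swap′ : ∀ a b i → a + i + b ≡ a + b + i
            swap′ = solve-∀
            spread : ∀ k a b i → k * (a + i) + b ≡ k * a + b + k * i
            spread = solve-∀
            factor : ∀ s k a b → - s * (k * a + (b + 1ℤ) + k * k) + s * (k * (a + k * + 2) + b) ≡ s * ((k + 1ℤ) * (k - 1ℤ))
            factor = solve-∀

    rectSum-torsion : ∀ l r → rectSum (torsion k) 0ℤ 0ℤ (suc (l ℕ.* 2)) (r ℕ.* 2) ≡ - + r
    rectSum-torsion l r = begin
      ∑[ i < P ] ∑[ j < Q ] (alt (i ℕ.+ j) * (+ k * + i + + j))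
        ≡⟨ ∑-cong P (λ i → ∑-cong Q (λ j → trans (cong (_* (+ k * + i + + j)) (alt-+ i j)) (expand (alt i) (alt j) (+ k) (+ i) (+ j)))) ⟩
      ∑[ i < P ] ∑[ j < Q ] (+ k * (alt i * + i) * alt j + alt i * (alt j * + j))
        ≡⟨ ∑-cong P (λ i → ∑-distrib-+ Q (λ j → + k * (alt i * + i) * alt j) (λ j → alt i * (alt j * + j))) ⟩
      ∑[ i < P ] (∑[ j < Q ] (+ k * (alt i * + i) * alt j) + ∑[ j < Q ] (alt i * (alt j * + j)))
        ≡⟨ ∑-distrib-+ P (λ i → ∑[ j < Q ] (+ k * (alt i * + i) * alt j)) (λ i → ∑[ j < Q ] (alt i * (alt j * + j))) ⟩
      ∑[ i < P ] ∑[ j < Q ] (+ k * (alt i * + i) * alt j) + ∑[ i < P ] ∑[ j < Q ] (alt i * (alt j * + j))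
        ≡⟨ cong₂ _+_ (∑-product P Q (λ i → + k * (alt i * + i)) alt) (∑-product P Q alt (λ j → alt j * + j)) ⟩
      ∑[ i < P ] (+ k * (alt i * + i)) * ∑ Q alt + ∑ P alt * ∑[ j < Q ] (alt j * + j)
        ≡⟨ cong₂ (λ u v → ∑[ i < P ] (+ k * (alt i * + i)) * u + v) (∑-alt-even r)
                 (cong₂ _*_ (∑-alt-odd l) (∑-alt-id-even r)) ⟩
      ∑[ i < P ] (+ k * (alt i * + i)) * 0ℤ + 1ℤ * - + r
        ≡⟨ simplify (∑[ i < P ] (+ k * (alt i * + i))) (+ r) ⟩
      - + r ∎
      where
      P Q : ℕ
      P = suc (l ℕ.* 2)
      Q = r ℕ.* 2
      expand : ∀ s t k i j → s * t * (k * i + j) ≡ k * (s * i) * t + s * (t * j)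
      expand = solve-∀
      simplify : ∀ t r → t * 0ℤ + 1ℤ * - r ≡ - r
      simplify = solve-∀

  ∑-indicator-≟ : ∀ x q → ∑[ y < q ] indicator ⌊ x ℕ.≟ y ⌋ ≡ indicator ⌊ x ℕ.<? q ⌋
  ∑-indicator-≟ x zero    = refl
  ∑-indicator-≟ x (suc q) = begin
    ∑[ y < suc q ] indicator ⌊ x ℕ.≟ y ⌋                     ≡⟨ ∑-last q (λ y → indicator ⌊ x ℕ.≟ y ⌋) ⟩
    ∑[ y < q ] indicator ⌊ x ℕ.≟ y ⌋ + indicator ⌊ x ℕ.≟ q ⌋ ≡⟨ cong (_+ indicator ⌊ x ℕ.≟ q ⌋) (∑-indicator-≟ x q) ⟩
    indicator ⌊ x ℕ.<? q ⌋ + indicator ⌊ x ℕ.≟ q ⌋           ≡⟨ step (x ℕ.<? q) (x ℕ.≟ q) (x ℕ.<? suc q) ⟩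
    indicator ⌊ x ℕ.<? suc q ⌋                               ∎
    where
    step : (x<q : Dec (x ℕ.< q)) (x≡q : Dec (x ≡ q)) (x≤q : Dec (x ℕ.< suc q)) →
           indicator ⌊ x<q ⌋ + indicator ⌊ x≡q ⌋ ≡ indicator ⌊ x≤q ⌋
    step (yes x<q) (yes refl) _         = contradiction x<q (ℕP.<-irrefl refl)
    step (yes x<q) (no _)     (yes _)   = refl
    step (yes x<q) (no _)     (no x≮q)  = contradiction (ℕP.m<n⇒m<1+n x<q) x≮q
    step (no _)    (yes refl) (yes _)   = refl
    step (no _)    (yes refl) (no x≮q)  = contradiction (ℕP.n<1+n x) x≮q
    step (no x≮q)  (no x≢q)   (yes x≤q) = contradiction (ℕP.≤∧≢⇒< (ℕ.s≤s⁻¹ x≤q) x≢q) x≮q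
    step (no _)    (no _)     (no _)    = refl

  module Diagonal (m : ℕ) where
    open Tiles m

    n : ℕ
    n = suc (suc m)

    multiple : ℤ → ℤ
    multiple z = indicator ⌊ + n ∣? z ⌋

    private
      multiple-⇔ : ∀ {z w} → (+ n ℤD.∣ z → + n ℤD.∣ w) → (+ n ℤD.∣ w → + n ℤD.∣ z) → multiple z ≡ multiple w
      multiple-⇔ {z} {w} to from = cong indicator
        (trans (isYes≗does (+ n ∣? z)) (trans (does-⇔ (mk⇔ to from) (+ n ∣? z) (+ n ∣? w)) (sym (isYes≗does (+ n ∣? w)))))

    multiple-+n : ∀ z → multiple (z + + n) ≡ multiple z
    multiple-+n z = multiple-⇔ (λ h → ℤD.∣m+n∣n⇒∣m h ℤD.∣-refl) (λ h → ℤD.∣m∣n⇒∣m+n h ℤD.∣-refl)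

    multiple-neg : ∀ z → multiple (- z) ≡ multiple z
    multiple-neg z = multiple-⇔ (λ h → subst (+ n ℤD.∣_) (ℤP.neg-involutive z) (ℤD.∣m⇒∣-m h)) ℤD.∣m⇒∣-m

    multiple-0 : multiple 0ℤ ≡ 1ℤ
    multiple-0 with + n ∣? 0ℤ
    ... | yes _  = refl
    ... | no n∤0 = contradiction (divides 0ℤ refl) n∤0

    multiple-small : ∀ j → 0 ℕ.< j → j ℕ.< n → multiple (+ j) ≡ 0ℤ
    multiple-small (suc j) _ j<n with + n ∣? + suc j
    ... | yes n∣j = contradiction (ℕD.∣⇒≤ (ℤD.∣⇒∣ᵤ n∣j)) (ℕP.<⇒≱ j<n)
    ... | no  _   = refl

    private
      multiples : ℤ → ℤ
      multiples e = ∑[ i < n ] multiple (e + + i)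

      multiples-suc : ∀ e → multiples (e + 1ℤ) ≡ multiples e
      multiples-suc e = ∙-cancelˡ (multiple e) _ _ (begin
        multiple e + multiples (e + 1ℤ)
          ≡⟨ cong₂ _+_ (cong multiple (sym (ℤP.+-identityʳ e)))
                       (∑-cong n (λ i → cong multiple (ℤP.+-assoc e 1ℤ (+ i)))) ⟩
        ∑[ i < suc n ] multiple (e + + i)
          ≡⟨ ∑-last n (λ i → multiple (e + + i)) ⟩
        multiples e + multiple (e + + n)
          ≡⟨ cong (_+_ (multiples e)) (multiple-+n e) ⟩
        multiples e + multiple e
          ≡⟨ ℤP.+-comm (multiples e) (multiple e) ⟩
        multiple e + multiples e ∎)

      multiples-0 : multiples 0ℤ ≡ 1ℤ
      multiples-0 = cong₂ _+_ multiple-0 (∑-zero (suc m) (λ i i<n → multiple-small (suc i) (s≤s z≤n) (s≤s i<n)))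

    ∑-multiple-window : ∀ e → ∑[ i < n ] multiple (e + + i) ≡ 1ℤ
    ∑-multiple-window (+ zero)       = multiples-0
    ∑-multiple-window (+ suc k)      = trans (cong multiples (ℤP.+-comm 1ℤ (+ k))) (trans (multiples-suc (+ k)) (∑-multiple-window (+ k)))
    ∑-multiple-window -[1+ zero ]    = trans (sym (multiples-suc -[1+ zero ])) multiples-0
    ∑-multiple-window -[1+ suc k ]   = trans (sym (multiples-suc -[1+ suc k ])) (∑-multiple-window -[1+ k ])

    diag : ℤ → ℤ
    diag z = + n * multiple z - 1ℤ

    -- A tile meets each residue class of y − x modulo n exactly once, so its sum is n − n = 0.
    diagonal : Cell → ℤ
    diagonal (x , y) = diag (y - x)

    diag-neg : ∀ z → diag (- z) ≡ diag z
    diag-neg z = cong (λ t → + n * t - 1ℤ) (multiple-neg z)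

    ∑-diag-window : ∀ e → ∑[ i < n ] diag (e + + i) ≡ 0ℤ
    ∑-diag-window e = begin
      ∑[ i < n ] (+ n * multiple (e + + i) - 1ℤ)     ≡⟨ ∑-affine n (+ n) 1ℤ (λ i → multiple (e + + i)) ⟩
      + n * ∑[ i < n ] multiple (e + + i) - + n * 1ℤ  ≡⟨ cong (λ t → + n * t - + n * 1ℤ) (∑-multiple-window e) ⟩
      + n * 1ℤ - + n * 1ℤ                             ≡⟨ ℤP.+-inverseʳ (+ n * 1ℤ) ⟩
      0ℤ                                              ∎

    private
      window-front : ∀ e (X : ℕ → ℤ) Y → (∀ j → X j ≡ diag (e + + suc j)) → Y ≡ diag e → ∑ (suc m) X + Y ≡ 0ℤ
      window-front e X Y X≡ Y≡ = begin
        ∑ (suc m) X + Y                                         ≡⟨ ℤP.+-comm (∑ (suc m) X) Y ⟩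
        Y + ∑ (suc m) X                                         ≡⟨ cong₂ _+_ (trans Y≡ (cong diag (sym (ℤP.+-identityʳ e)))) (∑-cong (suc m) X≡) ⟩
        ∑[ i < n ] diag (e + + i)                               ≡⟨ ∑-diag-window e ⟩
        0ℤ                                                      ∎

      window-back : ∀ e (X : ℕ → ℤ) Y → (∀ j → X j ≡ diag (e + + j)) → Y ≡ diag (e + + suc m) → ∑ (suc m) X + Y ≡ 0ℤ
      window-back e X Y X≡ Y≡ = begin
        ∑ (suc m) X + Y                                         ≡⟨ cong₂ _+_ (∑-cong (suc m) X≡) Y≡ ⟩
        ∑[ i < suc m ] diag (e + + i) + diag (e + + suc m)      ≡⟨ sym (∑-last (suc m) (λ i → diag (e + + i))) ⟩
        ∑[ i < n ] diag (e + + i)                               ≡⟨ ∑-diag-window e ⟩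
        0ℤ                                                      ∎

    diagonal-tileSum : ∀ s a b → tileSum diagonal s a b ≡ 0ℤ
    diagonal-tileSum zero a b =
      window-front (b - a - 1ℤ) (λ j → diagonal (a , b + + j)) (diagonal (a + 1ℤ , b))
        (λ j → cong diag (shift a b (+ j))) (cong diag (shift′ a b))
      where shift : ∀ a b j → b + j - a ≡ b - a - 1ℤ + (1ℤ + j)
            shift = solve-∀
            shift′ : ∀ a b → b - (a + 1ℤ) ≡ b - a - 1ℤ
            shift′ = solve-∀
    diagonal-tileSum (suc zero) a b =
      window-back (b - a - 1ℤ) (λ j → diagonal (a + 1ℤ , b + + j)) (diagonal (a , b + + m))
        (λ j → cong diag (shift a b (+ j))) (cong diag (shift′ a b (+ m)))
      where shift : ∀ a b j → b + j - (a + 1ℤ) ≡ b - a - 1ℤ + j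
            shift = solve-∀
            shift′ : ∀ a b m → b + m - a ≡ b - a - 1ℤ + (1ℤ + m)
            shift′ = solve-∀
    diagonal-tileSum (suc (suc zero)) a b =
      window-front (a - b - 1ℤ) (λ i → diagonal (a + + i , b)) (diagonal (a , b + 1ℤ))
        (λ i → trans (cong diag (flip a b (+ i))) (diag-neg (a - b - 1ℤ + + suc i)))
        (trans (cong diag (flip′ a b)) (diag-neg (a - b - 1ℤ)))
      where flip : ∀ a b i → b - (a + i) ≡ - (a - b - 1ℤ + (1ℤ + i))
            flip = solve-∀
            flip′ : ∀ a b → b + 1ℤ - a ≡ - (a - b - 1ℤ)
            flip′ = solve-∀
    diagonal-tileSum (suc (suc (suc zero))) a b =
      window-back (a - b - 1ℤ) (λ i → diagonal (a + + i , b + 1ℤ)) (diagonal (a + + m , b))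
        (λ i → trans (cong diag (flip a b (+ i))) (diag-neg (a - b - 1ℤ + + i)))
        (trans (cong diag (flip′ a b (+ m))) (diag-neg (a - b - 1ℤ + + suc m)))
      where flip : ∀ a b i → b + 1ℤ - (a + i) ≡ - (a - b - 1ℤ + i)
            flip = solve-∀
            flip′ : ∀ a b m → b - (a + m) ≡ - (a - b - 1ℤ + (1ℤ + m))
            flip′ = solve-∀

    diagonalSum : ℕ → ℕ → ℤ
    diagonalSum = rectSum diagonal 0ℤ 0ℤ

    diagonalSum-+n-width : ∀ p q → diagonalSum (p ℕ.+ n) q ≡ diagonalSum p q
    diagonalSum-+n-width p q = begin
      diagonalSum (p ℕ.+ n) q
        ≡⟨ ∑-split p n (λ x → ∑[ y < q ] diag (+ y - + x)) ⟩
      diagonalSum p q + ∑[ x < n ] ∑[ y < q ] diag (+ y - + (p ℕ.+ x))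
        ≡⟨ cong (_+_ (diagonalSum p q)) (∑-comm n q (λ x y → diag (+ y - + (p ℕ.+ x)))) ⟩
      diagonalSum p q + ∑[ y < q ] ∑[ x < n ] diag (+ y - + (p ℕ.+ x))
        ≡⟨ cong (_+_ (diagonalSum p q)) (∑-zero q (λ y _ → trans (∑-cong n (λ x → reflect (+ y) (+ p) (+ x)))
                                                                   (∑-diag-window (+ p - + y)))) ⟩
      diagonalSum p q + 0ℤ
        ≡⟨ ℤP.+-identityʳ (diagonalSum p q) ⟩
      diagonalSum p q ∎
      where flip : ∀ y p x → y - (p + x) ≡ - (p - y + x)
            flip = solve-∀
            reflect : ∀ y p x → diag (y - (p + x)) ≡ diag (p - y + x)
            reflect y p x = trans (cong diag (flip y p x)) (diag-neg (p - y + x))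

    diagonalSum-+n-height : ∀ p q → diagonalSum p (q ℕ.+ n) ≡ diagonalSum p q
    diagonalSum-+n-height p q = begin
      diagonalSum p (q ℕ.+ n)
        ≡⟨ ∑-cong p (λ x → ∑-split q n (λ y → diag (+ y - + x))) ⟩
      ∑[ x < p ] (∑[ y < q ] diag (+ y - + x) + ∑[ y < n ] diag (+ (q ℕ.+ y) - + x))
        ≡⟨ ∑-distrib-+ p (λ x → ∑[ y < q ] diag (+ y - + x)) (λ x → ∑[ y < n ] diag (+ (q ℕ.+ y) - + x)) ⟩
      diagonalSum p q + ∑[ x < p ] ∑[ y < n ] diag (+ (q ℕ.+ y) - + x)
        ≡⟨ cong (_+_ (diagonalSum p q)) (∑-zero p (λ x _ → trans (∑-cong n (λ y → cong diag (shift (+ x) (+ q) (+ y))))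
                                                           (∑-diag-window (+ q - + x)))) ⟩
      diagonalSum p q + 0ℤ
        ≡⟨ ℤP.+-identityʳ (diagonalSum p q) ⟩
      diagonalSum p q ∎
      where shift : ∀ x q y → q + y - x ≡ q - x + y
            shift = solve-∀

    diagonalSum-mod : ∀ p q → diagonalSum p q ≡ diagonalSum (p % n) (q % n)
    diagonalSum-mod p q = begin
      diagonalSum p q                                        ≡⟨ cong₂ diagonalSum (m≡m%n+[m/n]*n p n) (m≡m%n+[m/n]*n q n) ⟩
      diagonalSum (p % n ℕ.+ p / n ℕ.* n) (q % n ℕ.+ q / n ℕ.* n) ≡⟨ width (p % n) (p / n) (q % n ℕ.+ q / n ℕ.* n) ⟩
      diagonalSum (p % n) (q % n ℕ.+ q / n ℕ.* n)            ≡⟨ height (p % n) (q % n) (q / n) ⟩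
      diagonalSum (p % n) (q % n)                            ∎
      where
      regroup : ∀ r t → r ℕ.+ suc t ℕ.* n ≡ r ℕ.+ t ℕ.* n ℕ.+ n
      regroup r t = trans (cong (r ℕ.+_) (ℕP.+-comm n (t ℕ.* n))) (sym (ℕP.+-assoc r (t ℕ.* n) n))
      width : ∀ r t q → diagonalSum (r ℕ.+ t ℕ.* n) q ≡ diagonalSum r q
      width r zero    q = cong (λ w → diagonalSum w q) (ℕP.+-identityʳ r)
      width r (suc t) q = trans (cong (λ w → diagonalSum w q) (regroup r t)) (trans (diagonalSum-+n-width (r ℕ.+ t ℕ.* n) q) (width r t q))
      height : ∀ p r t → diagonalSum p (r ℕ.+ t ℕ.* n) ≡ diagonalSum p r
      height p r zero    = cong (diagonalSum p) (ℕP.+-identityʳ r)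
      height p r (suc t) = trans (cong (diagonalSum p) (regroup r t)) (trans (diagonalSum-+n-height p (r ℕ.+ t ℕ.* n)) (height p r t))

    diagonalSum-sym : ∀ p q → diagonalSum p q ≡ diagonalSum q p
    diagonalSum-sym p q = trans (∑-comm p q (λ x y → diag (+ y - + x)))
                      (∑-cong q (λ y → ∑-cong p (λ x → trans (cong diag (flip (+ x) (+ y))) (diag-neg (+ x - + y)))))
      where flip : ∀ x y → y - x ≡ - (x - y)
            flip = solve-∀

    multiple-difference : ∀ {x y} → x ℕ.< n → y ℕ.< n → multiple (+ y - + x) ≡ indicator ⌊ x ℕ.≟ y ⌋
    multiple-difference {x} {y} x<n y<n with x ℕ.≟ y
    ... | yes refl = trans (cong multiple (ℤP.+-inverseʳ (+ x))) multiple-0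
    ... | no x≢y with ℕP.<-cmp x y
    ...   | tri≈ _ x≡y _ = contradiction x≡y x≢y
    ...   | tri< x<y _ _ = trans (cong multiple (trans (ℤP.m-n≡m⊖n y x) (ℤP.⊖-≥ (ℕP.<⇒≤ x<y))))
                                 (multiple-small (y ∸ x) (ℕP.m<n⇒0<n∸m x<y) (ℕP.≤-<-trans (ℕP.m∸n≤m y x) y<n))
    ...   | tri> _ _ y<x = trans (cong multiple (flip (+ y) (+ x))) (trans (multiple-neg (+ x - + y))
                            (trans (cong multiple (trans (ℤP.m-n≡m⊖n x y) (ℤP.⊖-≥ (ℕP.<⇒≤ y<x))))
                                   (multiple-small (x ∸ y) (ℕP.m<n⇒0<n∸m y<x) (ℕP.≤-<-trans (ℕP.m∸n≤m x y) x<n))))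
      where flip : ∀ y x → y - x ≡ - (x - y)
            flip = solve-∀

    diagonalSum-small : ∀ {p q} → p ℕ.≤ q → q ℕ.≤ n → diagonalSum p q ≡ + p * (+ n - + q)
    diagonalSum-small {p} {q} p≤q q≤n = begin
      ∑[ x < p ] ∑[ y < q ] (+ n * multiple (+ y - + x) - 1ℤ)
        ≡⟨ ∑-cong p (λ x → ∑-affine q (+ n) 1ℤ (λ y → multiple (+ y - + x))) ⟩
      ∑[ x < p ] (+ n * ∑[ y < q ] multiple (+ y - + x) - + q * 1ℤ)
        ≡⟨ ∑-cong-< p (λ x x<p → cong (λ t → + n * t - + q * 1ℤ) (row x (ℕP.<-≤-trans x<p p≤q))) ⟩
      ∑[ x < p ] (+ n * 1ℤ - + q * 1ℤ)
        ≡⟨ ∑-const p _ ⟩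
      + p * (+ n * 1ℤ - + q * 1ℤ)
        ≡⟨ cong (_*_ (+ p)) (cong₂ _-_ (ℤP.*-identityʳ (+ n)) (ℤP.*-identityʳ (+ q))) ⟩
      + p * (+ n - + q) ∎
      where
      row : ∀ x → x ℕ.< q → ∑[ y < q ] multiple (+ y - + x) ≡ 1ℤ
      row x x<q = begin
        ∑[ y < q ] multiple (+ y - + x)    ≡⟨ ∑-cong-< q (λ y y<q → multiple-difference (ℕP.<-≤-trans x<q q≤n) (ℕP.<-≤-trans y<q q≤n)) ⟩
        ∑[ y < q ] indicator ⌊ x ℕ.≟ y ⌋  ≡⟨ ∑-indicator-≟ x q ⟩
        indicator ⌊ x ℕ.<? q ⌋            ≡⟨ cong indicator (trans (isYes≗does (x ℕ.<? q)) (dec-true (x ℕ.<? q) x<q)) ⟩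
        1ℤ                                 ∎

    diagonalSum-nonzero-≤ : ∀ {p q} → 0 ℕ.< p → p ℕ.≤ q → q ℕ.< n → ¬ diagonalSum p q ≡ 0ℤ
    diagonalSum-nonzero-≤ {p} {q} 0<p p≤q q<n sum≡0 with ℤP.i*j≡0⇒i≡0∨j≡0 (+ p) (trans (sym (diagonalSum-small p≤q (ℕP.<⇒≤ q<n))) sum≡0)
    ... | inj₁ p≡0   = ℕP.<⇒≢ 0<p (sym (ℤP.+-injective p≡0))
    ... | inj₂ n-q≡0 = ℕP.<⇒≢ q<n (ℤP.+-injective (sym (ℤP.i-j≡0⇒i≡j (+ n) (+ q) n-q≡0)))

    diagonalSum-nonzero : ∀ {p q} → 0 ℕ.< p → 0 ℕ.< q → p ℕ.< n → q ℕ.< n → ¬ diagonalSum p q ≡ 0ℤ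
    diagonalSum-nonzero {p} {q} 0<p 0<q p<n q<n with ℕP.≤-total p q
    ... | inj₁ p≤q = diagonalSum-nonzero-≤ 0<p p≤q q<n
    ... | inj₂ q≤p = λ sum≡0 → diagonalSum-nonzero-≤ 0<q q≤p p<n (trans (diagonalSum-sym q p) sum≡0)

    signedTileable⇒∣ : ∀ {p q} → SignedTileable n p q → n ℕD.∣ p ⊎ n ℕD.∣ q
    signedTileable⇒∣ {p} {q} tiled with p % n ℕ.≟ 0 | q % n ℕ.≟ 0
    ... | yes p%n≡0 | _         = inj₁ (ℕD.m%n≡0⇒n∣m p n p%n≡0)
    ... | no  _     | yes q%n≡0 = inj₂ (ℕD.m%n≡0⇒n∣m q n q%n≡0)
    ... | no  p%n≢0 | no  q%n≢0 =
      contradiction (trans (sym (diagonalSum-mod p q)) sum≡0)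
                    (diagonalSum-nonzero (ℕP.n≢0⇒n>0 p%n≢0) (ℕP.n≢0⇒n>0 q%n≢0) (m%n<n p n) (m%n<n q n))
      where sum≡0 : diagonalSum p q ≡ 0ℤ
            sum≡0 = 0∣⇒≡0 (signedTiling-invariant diagonal 0ℤ (λ s a b → divides 0ℤ (diagonal-tileSum s a b)) tiled)

  -- Signed combinations of tiles

  Tileable : ℕ → (Cell → ℤ) → Set
  Tileable n g = Σ (List PlacedTile) λ ts → ∀ c → coverage n ts c ≡ g c

  module _ {n : ℕ} where

    tileable-cong : ∀ {g h} → (∀ c → g c ≡ h c) → Tileable n g → Tileable n h
    tileable-cong g≡h (ts , covers) = ts , λ c → trans (covers c) (g≡h c)

    tileable-zero : Tileable n (λ _ → 0ℤ)
    tileable-zero = [] , λ _ → refl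

    coverage-++ : ∀ ts us c → coverage n (ts ++ us) c ≡ coverage n ts c + coverage n us c
    coverage-++ []       us c = sym (ℤP.+-identityˡ _)
    coverage-++ (t ∷ ts) us c = trans (cong (_+_ (contrib n t c)) (coverage-++ ts us c)) (sym (ℤP.+-assoc (contrib n t c) _ _))

    tileable-+ : ∀ {g h} → Tileable n g → Tileable n h → Tileable n (λ c → g c + h c)
    tileable-+ (ts , g≡) (us , h≡) = ts ++ us , λ c → trans (coverage-++ ts us c) (cong₂ _+_ (g≡ c) (h≡ c))

    tileable-∑ : ∀ K (g : ℕ → Cell → ℤ) → (∀ t → Tileable n (g t)) → Tileable n (λ c → ∑[ t < K ] g t c)
    tileable-∑ zero    g tileable = tileable-zero
    tileable-∑ (suc K) g tileable = tileable-+ (tileable 0) (tileable-∑ K (λ t → g (suc t)) (λ t → tileable (suc t)))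

    private
      flipWeight : PlacedTile → PlacedTile
      flipWeight (placed s o Sign.+) = placed s o Sign.-
      flipWeight (placed s o Sign.-) = placed s o Sign.+

      contrib-flipWeight : ∀ t c → contrib n (flipWeight t) c ≡ - contrib n t c
      contrib-flipWeight (placed s (a , b) Sign.+) (x , y) with inShape n s (x - a , y - b)
      ... | true  = refl
      ... | false = refl
      contrib-flipWeight (placed s (a , b) Sign.-) (x , y) with inShape n s (x - a , y - b)
      ... | true  = refl
      ... | false = refl

      coverage-flipWeight : ∀ ts c → coverage n (map flipWeight ts) c ≡ - coverage n ts c
      coverage-flipWeight []       c = refl
      coverage-flipWeight (t ∷ ts) c =
        trans (cong₂ _+_ (contrib-flipWeight t c) (coverage-flipWeight ts c)) (sym (ℤP.neg-distrib-+ (contrib n t c) _))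

    tileable-neg : ∀ {g} → Tileable n g → Tileable n (λ c → - g c)
    tileable-neg (ts , g≡) = map flipWeight ts , λ c → trans (coverage-flipWeight ts c) (cong -_ (g≡ c))

    tileable-sub : ∀ {g h} → Tileable n g → Tileable n h → Tileable n (λ c → g c - h c)
    tileable-sub tg th = tileable-+ tg (tileable-neg th)

    tileable-tile : ∀ s a b → Tileable n (λ (x , y) → indicator (inShape n s (x - a , y - b)))
    tileable-tile s a b = placed s (a , b) Sign.+ ∷ [] ,
      λ (x , y) → trans (ℤP.+-identityʳ _) (trans (if-indicator _ 1ℤ) (ℤP.*-identityˡ _))

    private
      translate : ℤ → ℤ → PlacedTile → PlacedTile
      translate dx dy (placed s (a , b) w) = placed s (a + dx , b + dy) w

      coverage-translate : ∀ dx dy ts x y → coverage n (map (translate dx dy) ts) (x , y) ≡ coverage n ts (x - dx , y - dy)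
      coverage-translate dx dy []                        x y = refl
      coverage-translate dx dy (placed s (a , b) w ∷ ts) x y =
        cong₂ _+_ (cong (λ c → if inShape n s c then signToℤ w else 0ℤ) (cong₂ _,_ (regroup x a dx) (regroup y b dy)))
                  (coverage-translate dx dy ts x y)
        where regroup : ∀ x a d → x - (a + d) ≡ x - d - a
              regroup = solve-∀

    tileable-translate : ∀ {g} dx dy → Tileable n g → Tileable n (λ (x , y) → g (x - dx , y - dy))
    tileable-translate dx dy (ts , g≡) = map (translate dx dy) ts , λ (x , y) → trans (coverage-translate dx dy ts x y) (g≡ _)

    private
      transposeShape : Fin 4 → Fin 4
      transposeShape zero                   = suc (suc zero)
      transposeShape (suc zero)             = suc (suc (suc zero))
      transposeShape (suc (suc zero))       = zero
      transposeShape (suc (suc (suc zero))) = suc zero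

      inShape-transpose : ∀ s i j → inShape n (transposeShape s) (i , j) ≡ inShape n s (j , i)
      inShape-transpose zero                   i j = cong (((j == 0ℤ) ∧ inRange 0ℤ (+ n - + 2) i) ∨_) (BoolP.∧-comm (i == 0ℤ) (j == 1ℤ))
      inShape-transpose (suc zero)             i j = cong (((j == 1ℤ) ∧ inRange 0ℤ (+ n - + 2) i) ∨_) (BoolP.∧-comm (i == (+ n - + 2)) (j == 0ℤ))
      inShape-transpose (suc (suc zero))       i j = cong (((i == 0ℤ) ∧ inRange 0ℤ (+ n - + 2) j) ∨_) (BoolP.∧-comm (i == 1ℤ) (j == 0ℤ))
      inShape-transpose (suc (suc (suc zero))) i j = cong (((i == 1ℤ) ∧ inRange 0ℤ (+ n - + 2) j) ∨_) (BoolP.∧-comm (i == 0ℤ) (j == (+ n - + 2)))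

      transpose : PlacedTile → PlacedTile
      transpose (placed s (a , b) w) = placed (transposeShape s) (b , a) w

      coverage-transpose : ∀ ts x y → coverage n (map transpose ts) (x , y) ≡ coverage n ts (y , x)
      coverage-transpose []                        x y = refl
      coverage-transpose (placed s (a , b) w ∷ ts) x y =
        cong₂ _+_ (cong (λ u → if u then signToℤ w else 0ℤ) (inShape-transpose s (x - b) (y - a))) (coverage-transpose ts x y)

    tileable-transpose : ∀ {g} → Tileable n g → Tileable n (λ (x , y) → g (y , x))
    tileable-transpose (ts , g≡) = map transpose ts , λ (x , y) → trans (coverage-transpose ts x y) (g≡ (y , x))

  cell : ℤ → ℤ → Cell → ℤ
  cell a b = rect a b 1 1

  module Construction (k : ℕ) where
    open Tiles (k ℕ.* 2)

    private
      m n : ℕ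
      m = k ℕ.* 2
      n = suc (suc m)

    tileable₀ : ∀ a b → Tileable n (λ c → rect a b 1 (suc m) c + cell (a + 1ℤ) b c)
    tileable₀ a b = tileable-cong (tile₀-rects a b) (tileable-tile zero a b)

    tileable₁ : ∀ a b → Tileable n (λ c → rect (a + 1ℤ) b 1 (suc m) c + cell a (b + + m) c)
    tileable₁ a b = tileable-cong (tile₁-rects a b) (tileable-tile (suc zero) a b)

    tileable₂ : ∀ a b → Tileable n (λ c → rect a b (suc m) 1 c + cell a (b + 1ℤ) c)
    tileable₂ a b = tileable-cong (tile₂-rects a b) (tileable-tile (suc (suc zero)) a b)

    cell-move : ∀ a b → Tileable n (λ c → cell (a + 1ℤ) b c - cell (a - 1ℤ) (b + + m) c)
    cell-move a b = tileable-cong difference (tileable-sub (tileable₀ a b) (tileable₁ (a - 1ℤ) b))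
      where
      difference : ∀ c → rect a b 1 (suc m) c + cell (a + 1ℤ) b c - (rect (a - 1ℤ + 1ℤ) b 1 (suc m) c + cell (a - 1ℤ) (b + + m) c)
                       ≡ cell (a + 1ℤ) b c - cell (a - 1ℤ) (b + + m) c
      difference c = begin
        rect a b 1 (suc m) c + cell (a + 1ℤ) b c - (rect (a - 1ℤ + 1ℤ) b 1 (suc m) c + cell (a - 1ℤ) (b + + m) c)
          ≡⟨ cong (λ u → rect a b 1 (suc m) c + cell (a + 1ℤ) b c - (rect u b 1 (suc m) c + cell (a - 1ℤ) (b + + m) c)) (back a) ⟩
        rect a b 1 (suc m) c + cell (a + 1ℤ) b c - (rect a b 1 (suc m) c + cell (a - 1ℤ) (b + + m) c)
          ≡⟨ cancel (rect a b 1 (suc m) c) (cell (a + 1ℤ) b c) (cell (a - 1ℤ) (b + + m) c) ⟩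
        cell (a + 1ℤ) b c - cell (a - 1ℤ) (b + + m) c ∎
        where back : ∀ a → a - 1ℤ + 1ℤ ≡ a
              back = solve-∀
              cancel : ∀ r x y → r + x - (r + y) ≡ x - y
              cancel = solve-∀

    cell-moves : ∀ t a b → Tileable n (λ c → cell (a + + (t ℕ.* 2)) b c - cell a (b + + (t ℕ.* m)) c)
    cell-moves zero a b = tileable-cong vanish tileable-zero
      where vanish : ∀ c → 0ℤ ≡ cell (a + + 0) b c - cell a (b + + 0) c
            vanish c = sym (trans (cong₂ (λ u v → cell u b c - cell a v c) (ℤP.+-identityʳ a) (ℤP.+-identityʳ b))
                                  (ℤP.+-inverseʳ (cell a b c)))
    cell-moves (suc t) a b = tileable-cong telescope (tileable-+ (cell-move (a + + (t ℕ.* 2) + 1ℤ) b) (cell-moves t a (b + + m)))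
      where
      telescope : ∀ c → cell (a + + (t ℕ.* 2) + 1ℤ + 1ℤ) b c - cell (a + + (t ℕ.* 2) + 1ℤ - 1ℤ) (b + + m) c
                          + (cell (a + + (t ℕ.* 2)) (b + + m) c - cell a (b + + m + + (t ℕ.* m)) c)
                      ≡ cell (a + + (suc t ℕ.* 2)) b c - cell a (b + + (suc t ℕ.* m)) c
      telescope c = begin
        cell (a + + (t ℕ.* 2) + 1ℤ + 1ℤ) b c - cell (a + + (t ℕ.* 2) + 1ℤ - 1ℤ) (b + + m) c
          + (cell (a + + (t ℕ.* 2)) (b + + m) c - cell a (b + + m + + (t ℕ.* m)) c)
          ≡⟨ cong₂ (λ u v → cell u b c - cell v (b + + m) c + (cell (a + + (t ℕ.* 2)) (b + + m) c - cell a (b + + m + + (t ℕ.* m)) c))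
                   (two a (+ (t ℕ.* 2))) (back a (+ (t ℕ.* 2))) ⟩
        cell (a + + (suc t ℕ.* 2)) b c - cell (a + + (t ℕ.* 2)) (b + + m) c
          + (cell (a + + (t ℕ.* 2)) (b + + m) c - cell a (b + + m + + (t ℕ.* m)) c)
          ≡⟨ cong (λ v → cell (a + + (suc t ℕ.* 2)) b c - cell (a + + (t ℕ.* 2)) (b + + m) c
                          + (cell (a + + (t ℕ.* 2)) (b + + m) c - cell a v c)) (ℤP.+-assoc b (+ m) (+ (t ℕ.* m))) ⟩
        cell (a + + (suc t ℕ.* 2)) b c - cell (a + + (t ℕ.* 2)) (b + + m) c
          + (cell (a + + (t ℕ.* 2)) (b + + m) c - cell a (b + + (suc t ℕ.* m)) c)
          ≡⟨ telescoping (cell (a + + (suc t ℕ.* 2)) b c) (cell (a + + (t ℕ.* 2)) (b + + m) c) (cell a (b + + (suc t ℕ.* m)) c) ⟩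
        cell (a + + (suc t ℕ.* 2)) b c - cell a (b + + (suc t ℕ.* m)) c ∎
        where two : ∀ a i → a + i + 1ℤ + 1ℤ ≡ a + (+ 2 + i)
              two = solve-∀
              back : ∀ a i → a + i + 1ℤ - 1ℤ ≡ a + i
              back = solve-∀
              telescoping : ∀ x y z → x - y + (y - z) ≡ x - z
              telescoping = solve-∀

    row-split : ∀ K a b c → rect a b (suc (K ℕ.* 2)) 1 c
      ≡ ∑[ t < suc K ] cell (a + + (t ℕ.* 2)) b c + ∑[ t < K ] cell (a + 1ℤ + + (t ℕ.* 2)) b c
    row-split zero a b c =
      sym (trans (ℤP.+-identityʳ _) (trans (ℤP.+-identityʳ _) (cong (λ u → cell u b c) (ℤP.+-identityʳ a))))
    row-split (suc K) a b c = begin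
      rect a b (suc (suc K ℕ.* 2)) 1 c
        ≡⟨ cong (λ w → rect a b w 1 c) (ℕP.+-comm 2 (suc (K ℕ.* 2))) ⟩
      rect a b (suc (K ℕ.* 2) ℕ.+ 2) 1 c
        ≡⟨ rect-split-width a b (suc (K ℕ.* 2)) 2 1 c ⟩
      rect a b (suc (K ℕ.* 2)) 1 c + rect (a + + suc (K ℕ.* 2)) b 2 1 c
        ≡⟨ cong₂ _+_ (row-split K a b c) (rect-split-width (a + + suc (K ℕ.* 2)) b 1 1 1 c) ⟩
      E K + O K + (cell (a + + suc (K ℕ.* 2)) b c + cell (a + + suc (K ℕ.* 2) + + 1) b c)
        ≡⟨ cong₂ (λ u v → E K + O K + (cell u b c + cell v b c)) (shift-odd a (+ (K ℕ.* 2))) (shift-even a (+ (K ℕ.* 2))) ⟩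
      E K + O K + (cell (a + 1ℤ + + (K ℕ.* 2)) b c + cell (a + + (suc K ℕ.* 2)) b c)
        ≡⟨ regroup (E K) (O K) (cell (a + 1ℤ + + (K ℕ.* 2)) b c) (cell (a + + (suc K ℕ.* 2)) b c) ⟩
      (E K + cell (a + + (suc K ℕ.* 2)) b c) + (O K + cell (a + 1ℤ + + (K ℕ.* 2)) b c)
        ≡⟨ sym (cong₂ _+_ (∑-last (suc K) (λ t → cell (a + + (t ℕ.* 2)) b c)) (∑-last K (λ t → cell (a + 1ℤ + + (t ℕ.* 2)) b c))) ⟩
      E (suc K) + O (suc K) ∎
      where
      E O : ℕ → ℤ
      E K = ∑[ t < suc K ] cell (a + + (t ℕ.* 2)) b c
      O K = ∑[ t < K ] cell (a + 1ℤ + + (t ℕ.* 2)) b c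
      shift-odd : ∀ a i → a + (1ℤ + i) ≡ a + 1ℤ + i
      shift-odd = solve-∀
      shift-even : ∀ a i → a + (1ℤ + i) + 1ℤ ≡ a + (+ 2 + i)
      shift-even = solve-∀
      regroup : ∀ e o x y → e + o + (x + y) ≡ (e + y) + (o + x)
      regroup = solve-∀

    rods : ∀ K c → ∑[ t < K ] rect 0ℤ (+ (t ℕ.* m)) 1 (suc m) c ≡ ∑[ t < K ] cell 0ℤ (+ (t ℕ.* m)) c + rect 0ℤ 1ℤ 1 (K ℕ.* m) c
    rods zero    c = sym (trans (ℤP.+-identityˡ _) (rect-empty-height 0ℤ 1ℤ 1 c))
    rods (suc K) c = begin
      ∑[ t < suc K ] rect 0ℤ (+ (t ℕ.* m)) 1 (suc m) c
        ≡⟨ ∑-last K (λ t → rect 0ℤ (+ (t ℕ.* m)) 1 (suc m) c) ⟩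
      ∑[ t < K ] rect 0ℤ (+ (t ℕ.* m)) 1 (suc m) c + rect 0ℤ (+ (K ℕ.* m)) 1 (1 ℕ.+ m) c
        ≡⟨ cong₂ _+_ (rods K c) (rect-split-height 0ℤ (+ (K ℕ.* m)) 1 1 m c) ⟩
      D K + rect 0ℤ 1ℤ 1 (K ℕ.* m) c + (cell 0ℤ (+ (K ℕ.* m)) c + rect 0ℤ (+ (K ℕ.* m) + + 1) 1 m c)
        ≡⟨ cong (λ v → D K + rect 0ℤ 1ℤ 1 (K ℕ.* m) c + (cell 0ℤ (+ (K ℕ.* m)) c + rect 0ℤ v 1 m c))
                (cong +_ (ℕP.+-comm (K ℕ.* m) 1)) ⟩
      D K + rect 0ℤ 1ℤ 1 (K ℕ.* m) c + (cell 0ℤ (+ (K ℕ.* m)) c + rect 0ℤ (1ℤ + + (K ℕ.* m)) 1 m c)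
        ≡⟨ regroup (D K) (rect 0ℤ 1ℤ 1 (K ℕ.* m) c) (cell 0ℤ (+ (K ℕ.* m)) c) (rect 0ℤ (1ℤ + + (K ℕ.* m)) 1 m c) ⟩
      (D K + cell 0ℤ (+ (K ℕ.* m)) c) + (rect 0ℤ 1ℤ 1 (K ℕ.* m) c + rect 0ℤ (1ℤ + + (K ℕ.* m)) 1 m c)
        ≡⟨ cong₂ _+_ (sym (∑-last K (λ t → cell 0ℤ (+ (t ℕ.* m)) c))) (sym (rect-split-height 0ℤ 1ℤ 1 (K ℕ.* m) m c)) ⟩
      D (suc K) + rect 0ℤ 1ℤ 1 (K ℕ.* m ℕ.+ m) c
        ≡⟨ cong (λ w → D (suc K) + rect 0ℤ 1ℤ 1 w c) (ℕP.+-comm (K ℕ.* m) m) ⟩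
      D (suc K) + rect 0ℤ 1ℤ 1 (suc K ℕ.* m) c ∎
      where
      D : ℕ → ℤ
      D K = ∑[ t < K ] cell 0ℤ (+ (t ℕ.* m)) c
      regroup : ∀ d r x v → d + r + (x + v) ≡ (d + x) + (r + v)
      regroup = solve-∀

  -- Moving cells by (−2, m) turns the horizontal arm of a tile₂ into the feet of k stacked tile₀'s;
  -- what survives is a column of height k·m − 2 = n(k − 1), two cells above the origin.
  module Column (j : ℕ) where
    open Construction (suc j)

    private
      k m n : ℕ
      k = suc j
      m = k ℕ.* 2
      n = suc (suc m)

    column : Tileable n (rect 0ℤ 0ℤ 1 (n ℕ.* j))
    column = tileable-cong (λ (x , y) → trans (rect-translate 0ℤ (+ 2) 1 (n ℕ.* j) 0ℤ (- + 2) x y) refl)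
                           (tileable-translate 0ℤ (- + 2) (tileable-cong combination≡ combination))
      where
      N : ℕ
      N = n ℕ.* j
      combination : Tileable n (λ c → - (rect 0ℤ 0ℤ (suc m) 1 c + cell 0ℤ 1ℤ c)
                                       + ∑[ t < k ] (rect 0ℤ (+ (t ℕ.* m)) 1 (suc m) c + cell 1ℤ (+ (t ℕ.* m)) c)
                                       + ∑[ t < suc k ] (cell (+ (t ℕ.* 2)) 0ℤ c - cell 0ℤ (+ (t ℕ.* m)) c)
                                       + ∑[ t < k ] (cell (+ suc (t ℕ.* 2)) 0ℤ c - cell 1ℤ (+ (t ℕ.* m)) c))
      combination = tileable-+ (tileable-+ (tileable-+ (tileable-neg (tileable₂ 0ℤ 0ℤ))
                                                       (tileable-∑ k _ (λ t → tileable₀ 0ℤ (+ (t ℕ.* m)))))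
                                           (tileable-∑ (suc k) _ (λ t → cell-moves t 0ℤ 0ℤ)))
                               (tileable-∑ k _ (λ t → cell-moves t 1ℤ 0ℤ))
      km≡ : k ℕ.* m ≡ 1 ℕ.+ (N ℕ.+ 1)
      km≡ = solveℕ-∀′ j
        where solveℕ-∀′ : ∀ j → suc j ℕ.* (suc j ℕ.* 2) ≡ 1 ℕ.+ (suc (suc (suc j ℕ.* 2)) ℕ.* j ℕ.+ 1)
              solveℕ-∀′ = solveℕ-∀
      combination≡ : ∀ c → _ ≡ rect 0ℤ (+ 2) 1 N c
      combination≡ c = begin
        - (rect 0ℤ 0ℤ (suc m) 1 c + cell 0ℤ 1ℤ c)
          + ∑[ t < k ] (rect 0ℤ (+ (t ℕ.* m)) 1 (suc m) c + cell 1ℤ (+ (t ℕ.* m)) c)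
          + ∑[ t < suc k ] (cell (+ (t ℕ.* 2)) 0ℤ c - cell 0ℤ (+ (t ℕ.* m)) c)
          + ∑[ t < k ] (cell (+ suc (t ℕ.* 2)) 0ℤ c - cell 1ℤ (+ (t ℕ.* m)) c)
          ≡⟨ cong₂ (λ u v → - (u + cell 0ℤ 1ℤ c) + v + ∑[ t < suc k ] (cell (+ (t ℕ.* 2)) 0ℤ c - cell 0ℤ (+ (t ℕ.* m)) c)
                                                   + ∑[ t < k ] (cell (+ suc (t ℕ.* 2)) 0ℤ c - cell 1ℤ (+ (t ℕ.* m)) c))
                   (row-split k 0ℤ 0ℤ c)
                   (trans (∑-distrib-+ k (λ t → rect 0ℤ (+ (t ℕ.* m)) 1 (suc m) c) (λ t → cell 1ℤ (+ (t ℕ.* m)) c))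
                          (cong (_+ D₁) (rods k c))) ⟩
        - (Ev + Od + cell 0ℤ 1ℤ c) + (D₀ + rect 0ℤ 1ℤ 1 (k ℕ.* m) c + D₁)
          + ∑[ t < suc k ] (cell (+ (t ℕ.* 2)) 0ℤ c - cell 0ℤ (+ (t ℕ.* m)) c)
          + ∑[ t < k ] (cell (+ suc (t ℕ.* 2)) 0ℤ c - cell 1ℤ (+ (t ℕ.* m)) c)
          ≡⟨ cong₂ (λ u v → - (Ev + Od + cell 0ℤ 1ℤ c) + (D₀ + rect 0ℤ 1ℤ 1 (k ℕ.* m) c + D₁) + u + v)
                   (trans (∑-distrib-sub (suc k) (λ t → cell (+ (t ℕ.* 2)) 0ℤ c) (λ t → cell 0ℤ (+ (t ℕ.* m)) c))
                          (cong (_-_ Ev) (∑-last k (λ t → cell 0ℤ (+ (t ℕ.* m)) c))))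
                   (∑-distrib-sub k (λ t → cell (+ suc (t ℕ.* 2)) 0ℤ c) (λ t → cell 1ℤ (+ (t ℕ.* m)) c)) ⟩
        - (Ev + Od + cell 0ℤ 1ℤ c) + (D₀ + rect 0ℤ 1ℤ 1 (k ℕ.* m) c + D₁) + (Ev - (D₀ + cell 0ℤ (+ (k ℕ.* m)) c)) + (Od - D₁)
          ≡⟨ cong₂ (λ u v → - (Ev + Od + cell 0ℤ 1ℤ c) + (D₀ + u + D₁) + (Ev - (D₀ + cell 0ℤ v c)) + (Od - D₁))
                   (trans (cong (λ w → rect 0ℤ 1ℤ 1 w c) km≡) long-column) (cong +_ (trans km≡ (cong suc (ℕP.+-comm N 1)))) ⟩
        - (Ev + Od + cell 0ℤ 1ℤ c) + (D₀ + (cell 0ℤ 1ℤ c + (rect 0ℤ (+ 2) 1 N c + cell 0ℤ (+ 2 + + N) c)) + D₁)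
          + (Ev - (D₀ + cell 0ℤ (+ 2 + + N) c)) + (Od - D₁)
          ≡⟨ collapse Ev Od (cell 0ℤ 1ℤ c) D₀ D₁ (rect 0ℤ (+ 2) 1 N c) (cell 0ℤ (+ 2 + + N) c) ⟩
        rect 0ℤ (+ 2) 1 N c ∎
        where
        Ev Od D₀ D₁ : ℤ
        Ev = ∑[ t < suc k ] cell (+ (t ℕ.* 2)) 0ℤ c
        Od = ∑[ t < k ] cell (+ suc (t ℕ.* 2)) 0ℤ c
        D₀ = ∑[ t < k ] cell 0ℤ (+ (t ℕ.* m)) c
        D₁ = ∑[ t < k ] cell 1ℤ (+ (t ℕ.* m)) c
        long-column : rect 0ℤ 1ℤ 1 (1 ℕ.+ (N ℕ.+ 1)) c ≡ cell 0ℤ 1ℤ c + (rect 0ℤ (+ 2) 1 N c + cell 0ℤ (+ 2 + + N) c)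
        long-column = trans (rect-split-height 0ℤ 1ℤ 1 1 (N ℕ.+ 1) c)
                            (cong (_+_ (cell 0ℤ 1ℤ c)) (rect-split-height 0ℤ (+ 2) 1 N 1 c))
        collapse : ∀ ev od c₀₁ d₀ d₁ col top →
          - (ev + od + c₀₁) + (d₀ + (c₀₁ + (col + top)) + d₁) + (ev - (d₀ + top)) + (od - d₁) ≡ col
        collapse = solve-∀

  module Rectangles {n : ℕ} where

    Rect : ℕ → ℕ → Cell → ℤ
    Rect = rect 0ℤ 0ℤ

    glue-height : ∀ p q₁ q₂ → Tileable n (Rect p q₁) → Tileable n (Rect p q₂) → Tileable n (Rect p (q₁ ℕ.+ q₂))
    glue-height p q₁ q₂ t₁ t₂ = tileable-cong glued (tileable-+ t₁ (tileable-translate 0ℤ (+ q₁) t₂))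
      where glued : ∀ c → Rect p q₁ c + Rect p q₂ (proj₁ c - 0ℤ , proj₂ c - + q₁) ≡ Rect p (q₁ ℕ.+ q₂) c
            glued (x , y) = sym (trans (rect-split-height 0ℤ 0ℤ p q₁ q₂ (x , y))
                                       (cong (_+_ (Rect p q₁ (x , y))) (sym (rect-translate 0ℤ 0ℤ p q₂ 0ℤ (+ q₁) x y))))

    glue-width : ∀ p₁ p₂ q → Tileable n (Rect p₁ q) → Tileable n (Rect p₂ q) → Tileable n (Rect (p₁ ℕ.+ p₂) q)
    glue-width p₁ p₂ q t₁ t₂ = tileable-cong glued (tileable-+ t₁ (tileable-translate (+ p₁) 0ℤ t₂))
      where glued : ∀ c → Rect p₁ q c + Rect p₂ q (proj₁ c - + p₁ , proj₂ c - 0ℤ) ≡ Rect (p₁ ℕ.+ p₂) q c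
            glued (x , y) = sym (trans (rect-split-width 0ℤ 0ℤ p₁ p₂ q (x , y))
                                       (cong (_+_ (Rect p₁ q (x , y))) (sym (rect-translate 0ℤ 0ℤ p₂ q (+ p₁) 0ℤ x y))))

    stack-height : ∀ p q t → Tileable n (Rect p q) → Tileable n (Rect p (t ℕ.* q))
    stack-height p q zero    _     = tileable-cong (λ c → sym (rect-empty-height 0ℤ 0ℤ p c)) tileable-zero
    stack-height p q (suc t) tiled = glue-height p q (t ℕ.* q) tiled (stack-height p q t tiled)

    stack-width : ∀ p q t → Tileable n (Rect p q) → Tileable n (Rect (t ℕ.* p) q)
    stack-width p q zero    _     = tileable-cong (λ c → sym (rect-empty-width 0ℤ 0ℤ q c)) tileable-zero
    stack-width p q (suc t) tiled = glue-width p (t ℕ.* p) q tiled (stack-width p q t tiled)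

    transpose-rect : ∀ p q → Tileable n (Rect p q) → Tileable n (Rect q p)
    transpose-rect p q tiled = tileable-cong (λ (x , y) → rect-transpose 0ℤ 0ℤ p q x y) (tileable-transpose tiled)

    signedTileable⇔tileable : ∀ p q → SignedTileable n p q ⇔ Tileable n (Rect p q)
    signedTileable⇔tileable p q = mk⇔ (λ { (tiling ts covers) → ts , λ c → trans (covers c) (inRect-rect p q c) })
                                      (λ (ts , covers) → tiling ts (λ c → trans (covers c) (sym (inRect-rect p q c))))

    signedTileable-transpose : ∀ {p q} → SignedTileable n p q → SignedTileable n q p
    signedTileable-transpose {p} {q} tiled =
      Equivalence.from (signedTileable⇔tileable q p) (transpose-rect p q (Equivalence.to (signedTileable⇔tileable p q) tiled))

  module Domino (m : ℕ) where
    open Tiles m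
    open Rectangles {suc (suc m)}

    domino : Tileable (suc (suc m)) (Rect 2 (suc (suc m)))
    domino = tileable-cong two-columns (tileable-+ (tileable-cong (tile₀-rects 0ℤ 0ℤ) (tileable-tile zero 0ℤ 0ℤ))
                                                   (tileable-cong (tile₁-rects 0ℤ 1ℤ) (tileable-tile (suc zero) 0ℤ 1ℤ)))
      where
      two-columns : ∀ c → rect 0ℤ 0ℤ 1 (suc m) c + cell 1ℤ 0ℤ c + (rect 1ℤ 1ℤ 1 (suc m) c + cell 0ℤ (+ suc m) c)
                        ≡ Rect 2 (suc (suc m)) c
      two-columns c = sym (begin
        rect 0ℤ 0ℤ 2 (suc (suc m)) c
          ≡⟨ rect-split-width 0ℤ 0ℤ 1 1 (suc (suc m)) c ⟩
        rect 0ℤ 0ℤ 1 (suc (suc m)) c + rect 1ℤ 0ℤ 1 (1 ℕ.+ suc m) c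
          ≡⟨ cong₂ _+_ (trans (cong (λ h → rect 0ℤ 0ℤ 1 h c) (ℕP.+-comm 1 (suc m))) (rect-split-height 0ℤ 0ℤ 1 (suc m) 1 c))
                       (rect-split-height 1ℤ 0ℤ 1 1 (suc m) c) ⟩
        rect 0ℤ 0ℤ 1 (suc m) c + cell 0ℤ (+ suc m) c + (cell 1ℤ 0ℤ c + rect 1ℤ 1ℤ 1 (suc m) c)
          ≡⟨ regroup (rect 0ℤ 0ℤ 1 (suc m) c) (cell 0ℤ (+ suc m) c) (cell 1ℤ 0ℤ c) (rect 1ℤ 1ℤ 1 (suc m) c) ⟩
        rect 0ℤ 0ℤ 1 (suc m) c + cell 1ℤ 0ℤ c + (rect 1ℤ 1ℤ 1 (suc m) c + cell 0ℤ (+ suc m) c) ∎)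
        where regroup : ∀ a b c d → a + b + (c + d) ≡ a + c + (d + b)
              regroup = solve-∀

  data Parity : ℕ → Set where
    even : ∀ l → Parity (l ℕ.* 2)
    odd  : ∀ l → Parity (suc (l ℕ.* 2))

  parity : ∀ p → Parity p
  parity zero = even 0
  parity (suc p) with parity p
  ... | even l = odd l
  ... | odd  l = even (suc l)

  odd≢even : ∀ l q → suc (l ℕ.* 2) ≢ q ℕ.* 2
  odd≢even l       zero    ()
  odd≢even zero    (suc q) ()
  odd≢even (suc l) (suc q) eq = odd≢even l q (ℕP.suc-injective (ℕP.suc-injective eq))

  even-double : ∀ l → Even (l ℕ.* 2)
  even-double l = divides l refl

  odd-double+1 : ∀ l → Odd (suc (l ℕ.* 2))
  odd-double+1 l (divides q eq) = odd≢even l q eq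

  odd⇒double+1 : ∀ {p} → Odd p → ∃ λ l → p ≡ suc (l ℕ.* 2)
  odd⇒double+1 {p} p-odd with parity p
  ... | even l = contradiction (even-double l) p-odd
  ... | odd  l = l , refl

  module Main (j : ℕ) where

    private
      k m n N : ℕ
      k = suc j
      m = k ℕ.* 2
      n = suc (suc m)
      N = n ℕ.* j

    open Rectangles {n}
    open Tiles m using (signedTiling-invariant)

    Criterion : ℕ → ℕ → Set
    Criterion p q = (Even p × Even q × (n ℕD.∣ p ⊎ n ℕD.∣ q)) ⊎ ((Odd p × N ℕD.∣ q) ⊎ (Odd q × N ℕD.∣ p))

    odd×even-tileable⇒∣ : ∀ l r → SignedTileable n (suc (l ℕ.* 2)) (r ℕ.* 2) → N ℕD.∣ r ℕ.* 2
    odd×even-tileable⇒∣ l r tiled = double (subst₂ ℕD._∣_ modulus (ℤP.∣-i∣≡∣i∣ (+ r)) (ℤD.∣⇒∣ᵤ torsion∣))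
      where
      open Invariants k
      torsion∣ : (+ k + 1ℤ) * (+ k - 1ℤ) ℤD.∣ - + r
      torsion∣ = subst (ℤD._∣_ _) (rectSum-torsion l r) (signedTiling-invariant (torsion k) _ torsion-tileSum tiled)
      modulus : ℤ.∣ (+ k + 1ℤ) * (+ k - 1ℤ) ∣ ≡ suc k ℕ.* j
      modulus = trans (ℤP.∣i*j∣≡∣i∣*∣j∣ (+ k + 1ℤ) (+ j)) (cong (ℕ._* j) (ℕP.+-comm k 1))
      double : suc k ℕ.* j ℕD.∣ r → N ℕD.∣ r ℕ.* 2
      double (divides s refl) = divides s (rescale s j)
        where rescale : ∀ s j → s ℕ.* (suc (suc j) ℕ.* j) ℕ.* 2 ≡ s ℕ.* (suc (suc (suc j ℕ.* 2)) ℕ.* j)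
              rescale = solveℕ-∀

    necessity : ∀ p q → SignedTileable n p q → Criterion p q
    necessity p q tiled with parity p | parity q
    ... | even l | even r = inj₁ (even-double l , even-double r , Diagonal.signedTileable⇒∣ m tiled)
    ... | odd  l | even r = inj₂ (inj₁ (odd-double+1 l , odd×even-tileable⇒∣ l r tiled))
    ... | even l | odd  r = inj₂ (inj₂ (odd-double+1 r , odd×even-tileable⇒∣ r l (signedTileable-transpose tiled)))
    ... | odd  l | odd  r = contradiction tiled (Invariants.odd×odd-not-tileable k l r)

    even×multiple-tileable : ∀ {p q} → Even p → n ℕD.∣ q → Tileable n (Rect p q)
    even×multiple-tileable (divides a refl) (divides b refl) = stack-width 2 (b ℕ.* n) a (stack-height 2 n b (Domino.domino m))

    odd×multiple-tileable : ∀ {p q} → Odd p → N ℕD.∣ q → Tileable n (Rect p q)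
    odd×multiple-tileable p-odd (divides b refl) with odd⇒double+1 p-odd
    ... | l , refl = glue-width 1 (l ℕ.* 2) (b ℕ.* N) (stack-height 1 N b (Column.column j))
                       (subst (λ h → Tileable n (Rect (l ℕ.* 2) h)) (regroup b j n)
                              (even×multiple-tileable (even-double l) (divides (b ℕ.* j) refl)))
      where regroup : ∀ b j n → b ℕ.* j ℕ.* n ≡ b ℕ.* (n ℕ.* j)
            regroup = solveℕ-∀

    criterion⇒tileable : ∀ {p q} → Criterion p q → Tileable n (Rect p q)
    criterion⇒tileable (inj₁ (p-even , _ , inj₂ n∣q))    = even×multiple-tileable p-even n∣q
    criterion⇒tileable (inj₁ (_ , q-even , inj₁ n∣p))    = transpose-rect _ _ (even×multiple-tileable q-even n∣p)
    criterion⇒tileable (inj₂ (inj₁ (p-odd , N∣q)))        = odd×multiple-tileable p-odd N∣q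
    criterion⇒tileable (inj₂ (inj₂ (q-odd , N∣p)))        = transpose-rect _ _ (odd×multiple-tileable q-odd N∣p)

    characterisation : ∀ p q → SignedTileable n p q ⇔ Criterion p q
    characterisation p q = mk⇔ (necessity p q) (λ c → Equivalence.from (signedTileable⇔tileable p q) (criterion⇒tileable c))

open import Defs
open import Data.Nat using (ℕ; _≤_; _*_; _∸_; suc; s≤s)
open import Data.Nat.Divisibility using (_∣_; divides)
open import Data.Nat.DivMod using (_/_; m*n/n≡m)
open import Data.Product using (_×_)
open import Data.Sum using (_⊎_)
open import Function.Bundles using (_⇔_)
open import Relation.Binary.PropositionalEquality using (refl)

-- 6 ≤ n is only used to exclude n = 0 and n = 2.
theorem1 : (n : ℕ) → Even n → 6 ≤ n → (p q : ℕ) → 1 ≤ p → 1 ≤ q →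
    SignedTileable n p q ⇔
      ((Even p × Even q × (n ∣ p ⊎ n ∣ q))
        ⊎ ((Odd p × (n * (n / 2 ∸ 2)) ∣ q) ⊎ (Odd q × (n * (n / 2 ∸ 2)) ∣ p)))
theorem1 .(suc (suc j) * 2) (divides (suc (suc j)) refl) _ p q _ _
  rewrite m*n/n≡m (suc (suc j)) 2 ⦃ _ ⦄ = RibbonTilings.Main.characterisation j p q
theorem1 .(0 * 2) (divides 0 refl) () _ _ _ _
theorem1 .(1 * 2) (divides 1 refl) (s≤s (s≤s ())) _ _ _ _
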